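{- Let $m\ge1$ and suppose $X\subseteq\mathbb{N}^2$ is periodic modulo $m$ with indicator $f:(\mathbb{Z}/m\mathbb{Z})^2\to\{0,1\}$ (i.e. for all distinct $a,b\in\mathbb{N}$, $(a,b)\in X$ iff $f(a\bmod m,b\bmod m)=1$). Let $H$ be the directed graph on vertex set $\mathbb{Z}/m\mathbb{Z}$ with an edge $r\to s$ iff $f(r,s)=0$. For $n\ge1$ write $\ell_r(n)=|\{t\in[n]:t\equiv r\pmod m\}|$. For nonnegative integers $\ell_0,\dots,\ell_{m-1}$ with sum $n$, let $A_H(\ell_0,\dots,\ell_{m-1})$ be the number of words $w=w_1\cdots w_n$ over $\mathbb{Z}/m\mathbb{Z}$ with $|\{i:w_i=r\}|=\ell_r$ for all $r$ and such that $w_i\to w_{i+1}$ is an edge of $H$ for all $i\in[n-1]$. Then \[ d_X(\emptyset;n)=A_H\bigl(\ell_0(n),\dots,\ell_{m-1}(n)\bigr)\cdot\prod_{r\in\mathbb{Z}/m\mathbb{Z}}\ell_r(n)!. \] Moreover, the multivariate generating function \[ F(x;y_0,\dots,y_{m-1})=\sum_{n\ge1}\sum_{\ell_0+\cdots+\ell_{m-1}=n}A_H(\ell_0,\dots,\ell_{m-1})\,x^n y_0^{\ell_0}\cdots y_{m-1}^{\ell_{m-1}} \] is a rational function.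
   Context: $[n]=\{1,\dots,n\}$. For $\pi=\pi_1\cdots\pi_n\in\mathfrak{S}_n$, $\mathrm{XDes}(\pi)=\{i\in[n-1]:(\pi_i,\pi_{i+1})\in X\}$, and $d_X(\emptyset;n)$ is the number of $\pi\in\mathfrak{S}_n$ with $\mathrm{XDes}(\pi)=\emptyset$. -}

module Defs where

open import Data.Bool using (Bool; true; false; _∧_; not; if_then_else_)
open import Data.Nat as ℕ using (ℕ; zero; suc; _∸_; _≤ᵇ_; NonZero; _!)
open import Data.Fin as Fin using (Fin)
open import Data.List as List using (List; []; _∷_; length; map; concatMap; filterᵇ; allFin; applyUpTo)
open import Data.Nat.ListAction using (product)
open import Data.Nat.DivMod using (_mod_)
open import Data.Vec as Vec using (Vec)
open import Data.Integer as ℤ using (ℤ)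
open import Data.Product using (Σ; _×_; _,_)
open import Relation.Nullary using (does; ¬_)
open import Relation.Binary.PropositionalEquality using (_≡_)
import Data.Vec.Properties as VecP

range1 : ℕ → List ℕ
range1 n = applyUpTo suc n

words : {A : Set} → List A → ℕ → List (List A)
words xs zero    = [] ∷ []
words xs (suc k) = concatMap (λ a → map (a ∷_) (words xs k)) xs

elemℕ : ℕ → List ℕ → Bool
elemℕ a []       = false
elemℕ a (b ∷ bs) = does (a ℕ.≟ b) Data.Bool.∨ elemℕ a bs
  where import Data.Bool

distinctℕ : List ℕ → Bool
distinctℕ []       = true
distinctℕ (a ∷ as) = not (elemℕ a as) ∧ distinctℕ as

-- S_n, written in one-line notation π₁⋯πₙ: the words of length n over [n]
-- with pairwise distinct letters
Sym : ℕ → List (List ℕ)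
Sym n = filterᵇ distinctℕ (words (range1 n) n)

noXDes : (ℕ → ℕ → Bool) → List ℕ → Bool
noXDes X []               = true
noXDes X (a ∷ [])         = true
noXDes X (a ∷ b ∷ rest)   = not (X a b) ∧ noXDes X (b ∷ rest)

dX∅ : (ℕ → ℕ → Bool) → ℕ → ℕ
dX∅ X n = length (filterᵇ (noXDes X) (Sym n))

ellr : (m : ℕ) .{{_ : NonZero m}} → Fin m → ℕ → ℕ
ellr m r n = length (filterᵇ (λ t → does ((t mod m) Fin.≟ r)) (range1 n))

ellVec : (m : ℕ) .{{_ : NonZero m}} → ℕ → Vec ℕ m
ellVec m n = Vec.tabulate (λ r → ellr m r n)

prodFact : (m : ℕ) .{{_ : NonZero m}} → ℕ → ℕ
prodFact m n = product (map (λ r → ellr m r n !) (allFin m))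

-- H: edge r → s iff f(r,s) = 0 (i.e. f r s ≡ false)
isHWalk : {m : ℕ} → (Fin m → Fin m → Bool) → List (Fin m) → Bool
isHWalk f []             = true
isHWalk f (a ∷ [])       = true
isHWalk f (a ∷ b ∷ rest) = not (f a b) ∧ isHWalk f (b ∷ rest)

occ : {m : ℕ} → Fin m → List (Fin m) → ℕ
occ r w = length (filterᵇ (λ a → does (a Fin.≟ r)) w)

hasContent : {m : ℕ} → Vec ℕ m → List (Fin m) → Bool
hasContent {m} ℓ w = List.foldr _∧_ true (map (λ r → does (occ r w ℕ.≟ Vec.lookup ℓ r)) (allFin m))

AH : {m : ℕ} → (Fin m → Fin m → Bool) → Vec ℕ m → ℕ
AH {m} f ℓ = length (filterᵇ (λ w → hasContent ℓ w ∧ isHWalk f w)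
                             (words (allFin m) (Vec.sum ℓ)))

-- Formal power series in x, y₀,…,y_{m-1} with integer coefficients:
-- coefficient of x^n y^ℓ.
Series : ℕ → Set
Series m = ℕ → Vec ℕ m → ℤ

-- polynomials: finite lists of terms  c · x^a · y^α
Poly : ℕ → Set
Poly m = List (ℤ × ℕ × Vec ℕ m)

sumℤ : List ℤ → ℤ
sumℤ = List.foldr ℤ._+_ (ℤ.+ 0)

vecLeᵇ : {m : ℕ} → Vec ℕ m → Vec ℕ m → Bool
vecLeᵇ α ℓ = Vec.foldr _ _∧_ true (Vec.zipWith _≤ᵇ_ α ℓ)

polyCoeff : {m : ℕ} → Poly m → ℕ → Vec ℕ m → ℤ
polyCoeff P n ℓ = sumℤ (map (λ { (c , a , α) →
  if does (a ℕ.≟ n) ∧ does (VecP.≡-dec ℕ._≟_ α ℓ) then c else ℤ.+ 0 }) P)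

mulCoeff : {m : ℕ} → Poly m → Series m → ℕ → Vec ℕ m → ℤ
mulCoeff Q F n ℓ = sumℤ (map (λ { (c , a , α) →
  if (a ≤ᵇ n) ∧ vecLeᵇ α ℓ then c ℤ.* F (n ∸ a) (Vec.zipWith _∸_ ℓ α) else ℤ.+ 0 }) Q)

-- F is a rational function: F = P / Q with polynomials P, Q, Q(0) ≠ 0
IsRational : {m : ℕ} → Series m → Set
IsRational {m} F = Σ (Poly m) λ P → Σ (Poly m) λ Q →
  (¬ (polyCoeff Q 0 (Vec.replicate m 0) ≡ ℤ.+ 0)) ×
  (∀ n ℓ → mulCoeff Q F n ℓ ≡ polyCoeff P n ℓ)

genF : {m : ℕ} → (Fin m → Fin m → Bool) → Series m
genF f zero    ℓ = ℤ.+ 0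
genF f (suc n) ℓ = if does (Vec.sum ℓ ℕ.≟ suc n) then ℤ.+ (AH f ℓ) else ℤ.+ 0

-- X only sees residues: for distinct a and b, (a , b) ∈ X iff f (a mod m , b mod m) = 1.  So a permutation π
-- of [n] has no X-descent iff its residue word (π₁ mod m) ⋯ (πₙ mod m) is a walk in H, and every residue word
-- has content ℓ(n).  Conversely a word w of content ℓ(n) is the residue word of exactly ∏ᵣ ℓᵣ(n)! permutations,
-- since the numbers of residue r may fill the ℓᵣ(n) positions where w shows r in any order.
--
-- For rationality let G_s be the generating function of the H-walks starting at s.  Removing the first letter
-- gives G_s = x y_s (1 + Σ_{s → t} G_t), and F = Σ_s G_s.  A linear system D_i G_i = b_i + Σ_j M_ij G_j with
-- polynomial coefficients, where every D_i has nonzero and every M_ij zero constant term, is solved by Gaussian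
-- elimination: eliminating one unknown preserves this shape, and a last equation (D − M) G = b exhibits G as a
-- quotient of polynomials whose denominator has a nonzero constant term.

module Submission where

open import Data.Bool using (Bool)
open import Data.Nat using (ℕ; NonZero)
open import Data.Fin using (Fin)

module Counting where
  open import Defs using (words)
  open import Data.Bool using (Bool; true; false; _∧_; if_then_else_)
  open import Data.Nat using (ℕ; zero; suc; _+_; _*_)
  import Data.Nat.Properties as ℕP
  open import Data.Nat.ListAction using (sum)
  open import Data.Nat.ListAction.Properties using (sum-++)
  open import Data.List using (List; []; _∷_; map; concatMap; filterᵇ; length; allFin)
  import Data.List.Properties as ListP
  open import Data.Fin using (Fin; zero; suc)
  open import Function using (_∘_; id)
  open import Relation.Binary.PropositionalEquality
  open import Algebra.Properties.CommutativeSemigroup ℕP.+-commutativeSemigroup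
    using () renaming (interchange to +-interchange)

  private variable
    A B : Set

  sumOver : List A → (A → ℕ) → ℕ
  sumOver xs g = sum (map g xs)

  syntax sumOver xs (λ x → e) = ∑[ x ∈ xs ] e

  ⟦_⟧ : Bool → ℕ
  ⟦ b ⟧ = if b then 1 else 0

  count : (A → Bool) → List A → ℕ
  count p xs = ∑[ x ∈ xs ] ⟦ p x ⟧

  ∑-cong : ∀ (xs : List A) {g h : A → ℕ} → (∀ x → g x ≡ h x) → ∑[ x ∈ xs ] g x ≡ ∑[ x ∈ xs ] h x
  ∑-cong xs g≗h = cong sum (ListP.map-cong g≗h xs)

  ∑-zero : ∀ (xs : List A) → ∑[ x ∈ xs ] 0 ≡ 0
  ∑-zero []       = refl
  ∑-zero (x ∷ xs) = ∑-zero xs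

  ∑-*ˡ : ∀ c (g : A → ℕ) xs → ∑[ x ∈ xs ] (c * g x) ≡ c * ∑[ x ∈ xs ] g x
  ∑-*ˡ c g []       = sym (ℕP.*-zeroʳ c)
  ∑-*ˡ c g (x ∷ xs) = trans (cong (c * g x +_) (∑-*ˡ c g xs)) (sym (ℕP.*-distribˡ-+ c (g x) _))

  ∑-concatMap : ∀ (h : A → List B) xs (g : B → ℕ) →
                ∑[ y ∈ concatMap h xs ] g y ≡ ∑[ x ∈ xs ] ∑[ y ∈ h x ] g y
  ∑-concatMap h []       g = refl
  ∑-concatMap h (x ∷ xs) g = begin
    sum (map g (h x Data.List.++ concatMap h xs))        ≡⟨ cong sum (ListP.map-++ g (h x) _) ⟩
    sum (map g (h x) Data.List.++ map g (concatMap h xs)) ≡⟨ sum-++ (map g (h x)) _ ⟩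
    sumOver (h x) g + sumOver (concatMap h xs) g         ≡⟨ cong (sumOver (h x) g +_) (∑-concatMap h xs g) ⟩
    sumOver (h x) g + ∑[ x′ ∈ xs ] sumOver (h x′) g       ∎
    where open ≡-Reasoning

  ∑-filterᵇ : ∀ (q : A → Bool) (g : A → ℕ) xs →
              ∑[ x ∈ filterᵇ q xs ] g x ≡ ∑[ x ∈ xs ] (if q x then g x else 0)
  ∑-filterᵇ q g []       = refl
  ∑-filterᵇ q g (x ∷ xs) with q x
  ... | true  = cong (g x +_) (∑-filterᵇ q g xs)
  ... | false = ∑-filterᵇ q g xs

  length-filterᵇ : ∀ (p : A → Bool) xs → length (filterᵇ p xs) ≡ count p xs
  length-filterᵇ p []       = refl
  length-filterᵇ p (x ∷ xs) with p x
  ... | true  = cong suc (length-filterᵇ p xs)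
  ... | false = length-filterᵇ p xs

  count-const-∧ : ∀ b (p : A → Bool) xs → count (λ x → b ∧ p x) xs ≡ (if b then count p xs else 0)
  count-const-∧ true  p xs = refl
  count-const-∧ false p xs = ∑-zero xs

  ∑-words-suc : ∀ (xs : List A) k (g : List A → ℕ) →
                ∑[ w ∈ words xs (suc k) ] g w ≡ ∑[ a ∈ xs ] ∑[ w ∈ words xs k ] g (a ∷ w)
  ∑-words-suc xs k g = trans (∑-concatMap (λ a → map (a ∷_) (words xs k)) xs g)
    (∑-cong xs (λ a → cong sum (sym (ListP.map-∘ (words xs k)))))

  ∑-words-cong : ∀ (xs : List A) k {g h : List A → ℕ} → (∀ w → length w ≡ k → g w ≡ h w) →
                 ∑[ w ∈ words xs k ] g w ≡ ∑[ w ∈ words xs k ] h w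
  ∑-words-cong xs zero    g≗h = cong (_+ 0) (g≗h [] refl)
  ∑-words-cong xs (suc k) {g} {h} g≗h = begin
    ∑[ w ∈ words xs (suc k) ] g w
      ≡⟨ ∑-words-suc xs k g ⟩
    ∑[ a ∈ xs ] ∑[ w ∈ words xs k ] g (a ∷ w)
      ≡⟨ ∑-cong xs (λ a → ∑-words-cong xs k (λ w → g≗h (a ∷ w) ∘ cong suc)) ⟩
    ∑[ a ∈ xs ] ∑[ w ∈ words xs k ] h (a ∷ w)
      ≡⟨ ∑-words-suc xs k h ⟨
    ∑[ w ∈ words xs (suc k) ] h w ∎
    where open ≡-Reasoning

  ∑-map : ∀ (h : A → B) (g : B → ℕ) xs → ∑[ y ∈ map h xs ] g y ≡ ∑[ x ∈ xs ] g (h x)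
  ∑-map h g xs = cong sum (sym (ListP.map-∘ xs))

  ∑-+ : ∀ (g h : A → ℕ) xs → ∑[ x ∈ xs ] (g x + h x) ≡ ∑[ x ∈ xs ] g x + ∑[ x ∈ xs ] h x
  ∑-+ g h []       = refl
  ∑-+ g h (x ∷ xs) = trans (cong (g x + h x +_) (∑-+ g h xs)) (+-interchange (g x) (h x) _ _)

  map-allFin-suc : ∀ {n} (h : Fin (suc n) → A) → map h (allFin (suc n)) ≡ h zero ∷ map (h ∘ suc) (allFin n)
  map-allFin-suc h = cong (h zero ∷_) (trans (ListP.map-tabulate suc h) (sym (ListP.map-tabulate id (h ∘ suc))))

  ∑-allFin-suc : ∀ {n} (h : Fin (suc n) → ℕ) → ∑[ i ∈ allFin (suc n) ] h i ≡ h zero + ∑[ i ∈ allFin n ] h (suc i)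
  ∑-allFin-suc h = cong sum (map-allFin-suc h)

  count-filterᵇ : ∀ (q p : A → Bool) xs → count p (filterᵇ q xs) ≡ count (λ x → q x ∧ p x) xs
  count-filterᵇ q p xs = trans (∑-filterᵇ q (λ x → ⟦ p x ⟧) xs) (∑-cong xs λ x → lemma (q x))
    where
    lemma : ∀ b {x} → (if b then ⟦ x ⟧ else 0) ≡ ⟦ b ∧ x ⟧
    lemma true  = refl
    lemma false = refl

module MultiIndex where
  open import Defs using (vecLeᵇ)
  open import Data.Bool using (Bool; true; _∧_)
  open import Data.Bool.Properties using (∧-commutativeMonoid)
  open import Data.Nat using (ℕ; zero; suc; _+_; _∸_; _≤ᵇ_; _≟_)
  import Data.Nat.Properties as ℕP
  open import Data.Vec using (Vec; []; _∷_; zipWith; replicate; sum)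
  import Data.Vec.Properties as VecP
  open import Relation.Nullary using (does; yes; no)
  open import Relation.Nullary.Decidable using (dec-true)
  open import Relation.Binary.PropositionalEquality
  open import Algebra.Bundles using (CommutativeMonoid)
  open import Algebra.Properties.CommutativeSemigroup
    (CommutativeMonoid.commutativeSemigroup ∧-commutativeMonoid) using (interchange)
  open import Algebra.Properties.CommutativeSemigroup ℕP.+-commutativeSemigroup
    using () renaming (interchange to +-interchange; x∙yz≈y∙xz to +-left-comm)

  private variable
    k : ℕ

  infixl 6 _+ᵛ_ _∸ᵛ_
  infix 4 _≟ᵛ_

  _+ᵛ_ _∸ᵛ_ : Vec ℕ k → Vec ℕ k → Vec ℕ k
  _+ᵛ_ = zipWith _+_
  _∸ᵛ_ = zipWith _∸_

  0ᵛ : Vec ℕ k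
  0ᵛ = replicate _ 0

  _≟ᵛ_ : (α β : Vec ℕ k) → Bool
  α ≟ᵛ β = does (VecP.≡-dec _≟_ α β)

  ≤ᵇ-suc : ∀ a n → (suc a ≤ᵇ suc n) ≡ (a ≤ᵇ n)
  ≤ᵇ-suc zero    n = refl
  ≤ᵇ-suc (suc a) n = refl

  ≤ᵇ-+ : ∀ a b n → (a + b ≤ᵇ n) ≡ (a ≤ᵇ n) ∧ (b ≤ᵇ n ∸ a)
  ≤ᵇ-+ zero    b n       = refl
  ≤ᵇ-+ (suc a) b zero    = refl
  ≤ᵇ-+ (suc a) b (suc n) = begin
    (suc (a + b) ≤ᵇ suc n)        ≡⟨ ≤ᵇ-suc (a + b) n ⟩
    (a + b ≤ᵇ n)                  ≡⟨ ≤ᵇ-+ a b n ⟩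
    (a ≤ᵇ n) ∧ (b ≤ᵇ n ∸ a)       ≡⟨ cong (_∧ (b ≤ᵇ n ∸ a)) (≤ᵇ-suc a n) ⟨
    (suc a ≤ᵇ suc n) ∧ (b ≤ᵇ n ∸ a) ∎
    where open ≡-Reasoning

  +-≟ : ∀ a b n → does (a + b ≟ n) ≡ (a ≤ᵇ n) ∧ does (b ≟ n ∸ a)
  +-≟ zero    b n       = refl
  +-≟ (suc a) b zero    = refl
  +-≟ (suc a) b (suc n) = trans (+-≟ a b n) (cong (_∧ does (b ≟ n ∸ a)) (sym (≤ᵇ-suc a n)))

  vecLeᵇ-+ᵛ : ∀ (α β ℓ : Vec ℕ k) → vecLeᵇ (α +ᵛ β) ℓ ≡ vecLeᵇ α ℓ ∧ vecLeᵇ β (ℓ ∸ᵛ α)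
  vecLeᵇ-+ᵛ []      []      []      = refl
  vecLeᵇ-+ᵛ (a ∷ α) (b ∷ β) (l ∷ ℓ) = trans (cong₂ _∧_ (≤ᵇ-+ a b l) (vecLeᵇ-+ᵛ α β ℓ))
    (interchange (a ≤ᵇ l) (b ≤ᵇ l ∸ a) (vecLeᵇ α ℓ) (vecLeᵇ β (ℓ ∸ᵛ α)))

  +ᵛ-≟ᵛ : ∀ (α β ℓ : Vec ℕ k) → (α +ᵛ β ≟ᵛ ℓ) ≡ vecLeᵇ α ℓ ∧ (β ≟ᵛ ℓ ∸ᵛ α)
  +ᵛ-≟ᵛ []      []      []      = refl
  +ᵛ-≟ᵛ (a ∷ α) (b ∷ β) (l ∷ ℓ) = trans (cong₂ _∧_ (+-≟ a b l) (+ᵛ-≟ᵛ α β ℓ))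
    (interchange (a ≤ᵇ l) (does (b ≟ l ∸ a)) (vecLeᵇ α ℓ) (β ≟ᵛ ℓ ∸ᵛ α))

  ∸ᵛ-+ᵛ : ∀ (ℓ α β : Vec ℕ k) → ℓ ∸ᵛ α ∸ᵛ β ≡ ℓ ∸ᵛ (α +ᵛ β)
  ∸ᵛ-+ᵛ []      []      []      = refl
  ∸ᵛ-+ᵛ (l ∷ ℓ) (a ∷ α) (b ∷ β) = cong₂ _∷_ (ℕP.∸-+-assoc l a b) (∸ᵛ-+ᵛ ℓ α β)

  +ᵛ-comm : ∀ (α β : Vec ℕ k) → α +ᵛ β ≡ β +ᵛ α
  +ᵛ-comm = VecP.zipWith-comm ℕP.+-comm

  +ᵛ-identityʳ : ∀ (α : Vec ℕ k) → α +ᵛ 0ᵛ ≡ α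
  +ᵛ-identityʳ []      = refl
  +ᵛ-identityʳ (a ∷ α) = cong₂ _∷_ (ℕP.+-identityʳ a) (+ᵛ-identityʳ α)

  0ᵛ-∸ᵛ : ∀ (α : Vec ℕ k) → 0ᵛ ∸ᵛ α ≡ 0ᵛ
  0ᵛ-∸ᵛ []      = refl
  0ᵛ-∸ᵛ (a ∷ α) = cong₂ _∷_ (ℕP.0∸n≡0 a) (0ᵛ-∸ᵛ α)

  ∸ᵛ-0ᵛ : ∀ (α : Vec ℕ k) → α ∸ᵛ 0ᵛ ≡ α
  ∸ᵛ-0ᵛ []      = refl
  ∸ᵛ-0ᵛ (a ∷ α) = cong (a ∷_) (∸ᵛ-0ᵛ α)

  vecLeᵇ-0ᵛ : ∀ (α : Vec ℕ k) → vecLeᵇ 0ᵛ α ≡ true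
  vecLeᵇ-0ᵛ []      = refl
  vecLeᵇ-0ᵛ (a ∷ α) = vecLeᵇ-0ᵛ α

  sum-0ᵛ : sum (0ᵛ {k}) ≡ 0
  sum-0ᵛ {zero}  = refl
  sum-0ᵛ {suc k} = sum-0ᵛ {k}

  sum-+ᵛ : ∀ (α β : Vec ℕ k) → sum (α +ᵛ β) ≡ sum α + sum β
  sum-+ᵛ []      []      = refl
  sum-+ᵛ (a ∷ α) (b ∷ β) = trans (cong (a + b +_) (sum-+ᵛ α β)) (+-interchange a b (sum α) (sum β))

  ≟ᵛ⇒≡ : ∀ {α β : Vec ℕ k} → (α ≟ᵛ β) ≡ true → α ≡ β
  ≟ᵛ⇒≡ {α = α} {β} h with VecP.≡-dec _≟_ α β
  ≟ᵛ⇒≡ _  | yes α≡β = α≡β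
  ≟ᵛ⇒≡ () | no _

  ≟ᵛ-refl : ∀ (α : Vec ℕ k) → (α ≟ᵛ α) ≡ true
  ≟ᵛ-refl α = dec-true (VecP.≡-dec _≟_ α α) refl

  +ᵛ-∸ᵛ-cancelˡ : ∀ (α β : Vec ℕ k) → α +ᵛ β ∸ᵛ α ≡ β
  +ᵛ-∸ᵛ-cancelˡ []      []      = refl
  +ᵛ-∸ᵛ-cancelˡ (a ∷ α) (b ∷ β) = cong₂ _∷_ (ℕP.m+n∸m≡n a b) (+ᵛ-∸ᵛ-cancelˡ α β)

  sum≡0⇒≡0ᵛ : ∀ (α : Vec ℕ k) → sum α ≡ 0 → α ≡ 0ᵛ
  sum≡0⇒≡0ᵛ []      _  = refl
  sum≡0⇒≡0ᵛ (a ∷ α) Σ≡0 = cong₂ _∷_ (ℕP.m+n≡0⇒m≡0 a Σ≡0) (sum≡0⇒≡0ᵛ α (ℕP.m+n≡0⇒n≡0 a Σ≡0))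

  +ᵛ-left-comm : ∀ (α β γ : Vec ℕ k) → α +ᵛ (β +ᵛ γ) ≡ β +ᵛ (α +ᵛ γ)
  +ᵛ-left-comm []      []      []      = refl
  +ᵛ-left-comm (a ∷ α) (b ∷ β) (c ∷ γ) = cong₂ _∷_ (+-left-comm a b c) (+ᵛ-left-comm α β γ)

module Content where
  open import Defs using (occ; hasContent; vecLeᵇ)
  open Counting using (⟦_⟧; sumOver; ∑-zero; ∑-cong; ∑-+; map-allFin-suc; ∑-allFin-suc)
  open MultiIndex
  open import Data.Bool using (Bool; true; false; _∧_)
  open import Data.Bool.Properties using (∧-identityʳ)
  open import Data.Nat as ℕ using (ℕ; zero; suc; _+_; _*_; _≤ᵇ_)
  import Data.Nat.Properties as ℕP
  open import Data.Fin as Fin using (Fin; zero; suc)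
  open import Data.Vec as Vec using (Vec; []; _∷_; lookup)
  import Data.Vec.Properties as VecP
  open import Data.List as List using (List; []; _∷_; map; allFin; length)
  import Data.List.Properties as ListP
  open import Relation.Nullary using (does)
  open import Relation.Binary.PropositionalEquality

  private variable
    m : ℕ

  𝕖 : Fin m → Vec ℕ m
  𝕖 zero    = 1 ∷ 0ᵛ
  𝕖 (suc s) = 0 ∷ 𝕖 s

  content : List (Fin m) → Vec ℕ m
  content []      = 0ᵛ
  content (s ∷ w) = 𝕖 s +ᵛ content w

  lookup-𝕖 : ∀ (s r : Fin m) → lookup (𝕖 s) r ≡ ⟦ does (s Fin.≟ r) ⟧
  lookup-𝕖 zero    zero    = refl
  lookup-𝕖 zero    (suc r) = VecP.lookup-replicate r 0
  lookup-𝕖 (suc s) zero    = refl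
  lookup-𝕖 (suc s) (suc r) = lookup-𝕖 s r

  lookup-content : ∀ (w : List (Fin m)) r → lookup (content w) r ≡ occ r w
  lookup-content []      r = VecP.lookup-replicate r 0
  lookup-content (s ∷ w) r
    rewrite VecP.lookup-zipWith _+_ r (𝕖 s) (content w) | lookup-𝕖 s r | lookup-content w r
    with does (s Fin.≟ r)
  ... | true  = refl
  ... | false = refl

  ≟ᵛ-pointwise : ∀ (α β : Vec ℕ m) →
    (α ≟ᵛ β) ≡ List.foldr _∧_ true (map (λ r → does (lookup α r ℕ.≟ lookup β r)) (allFin m))
  ≟ᵛ-pointwise []      []      = refl
  ≟ᵛ-pointwise (a ∷ α) (b ∷ β) = trans (cong (does (a ℕ.≟ b) ∧_) (≟ᵛ-pointwise α β))
    (cong (List.foldr _∧_ true) (sym (map-allFin-suc (λ r → does (lookup (a ∷ α) r ℕ.≟ lookup (b ∷ β) r)))))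

  hasContent≡content-≟ᵛ : ∀ (ℓ : Vec ℕ m) w → hasContent ℓ w ≡ (content w ≟ᵛ ℓ)
  hasContent≡content-≟ᵛ {m} ℓ w = trans
    (cong (List.foldr _∧_ true)
      (ListP.map-cong (λ r → cong (λ x → does (x ℕ.≟ lookup ℓ r)) (sym (lookup-content w r))) (allFin m)))
    (sym (≟ᵛ-pointwise (content w) ℓ))

  hasContent-[] : ∀ (ℓ : Vec ℕ m) → hasContent ℓ [] ≡ (0ᵛ ≟ᵛ ℓ)
  hasContent-[] ℓ = hasContent≡content-≟ᵛ ℓ []

  hasContent-∷ : ∀ (ℓ : Vec ℕ m) s w → hasContent ℓ (s ∷ w) ≡ vecLeᵇ (𝕖 s) ℓ ∧ hasContent (ℓ ∸ᵛ 𝕖 s) w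
  hasContent-∷ ℓ s w = begin
    hasContent ℓ (s ∷ w)
      ≡⟨ hasContent≡content-≟ᵛ ℓ (s ∷ w) ⟩
    (𝕖 s +ᵛ content w ≟ᵛ ℓ)
      ≡⟨ +ᵛ-≟ᵛ (𝕖 s) (content w) ℓ ⟩
    vecLeᵇ (𝕖 s) ℓ ∧ (content w ≟ᵛ ℓ ∸ᵛ 𝕖 s)
      ≡⟨ cong (vecLeᵇ (𝕖 s) ℓ ∧_) (hasContent≡content-≟ᵛ (ℓ ∸ᵛ 𝕖 s) w) ⟨
    vecLeᵇ (𝕖 s) ℓ ∧ hasContent (ℓ ∸ᵛ 𝕖 s) w ∎
    where open ≡-Reasoning

  sum-𝕖 : ∀ (s : Fin m) → Vec.sum (𝕖 s) ≡ 1
  sum-𝕖 {suc m} zero    = cong suc (sum-0ᵛ {m})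
  sum-𝕖         (suc s) = sum-𝕖 s

  sum-content : ∀ (w : List (Fin m)) → Vec.sum (content w) ≡ length w
  sum-content {m} []      = sum-0ᵛ {m}
  sum-content     (s ∷ w) = trans (sum-+ᵛ (𝕖 s) (content w)) (cong₂ _+_ (sum-𝕖 s) (sum-content w))

  hasContent⇒sum≡length : ∀ (ℓ : Vec ℕ m) w → hasContent ℓ w ≡ true → Vec.sum ℓ ≡ length w
  hasContent⇒sum≡length ℓ w h = trans (cong Vec.sum (sym content≡ℓ)) (sum-content w)
    where
    content≡ℓ : content w ≡ ℓ
    content≡ℓ = ≟ᵛ⇒≡ (trans (sym (hasContent≡content-≟ᵛ ℓ w)) h)

  vecLeᵇ-𝕖 : ∀ (s : Fin m) (ℓ : Vec ℕ m) → vecLeᵇ (𝕖 s) ℓ ≡ (1 ≤ᵇ lookup ℓ s)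
  vecLeᵇ-𝕖 zero    (l ∷ ℓ) = trans (cong ((1 ≤ᵇ l) ∧_) (vecLeᵇ-0ᵛ ℓ)) (∧-identityʳ _)
  vecLeᵇ-𝕖 (suc s) (l ∷ ℓ) = vecLeᵇ-𝕖 s ℓ

  ∑-indicator : ∀ (a : Fin m) (h : Fin m → ℕ) → ∑[ r ∈ allFin m ] (⟦ does (a Fin.≟ r) ⟧ * h r) ≡ h a
  ∑-indicator {suc m} zero    h = trans (∑-allFin-suc (λ r → ⟦ does (zero Fin.≟ r) ⟧ * h r))
    (trans (cong₂ _+_ (ℕP.+-identityʳ (h zero)) (∑-zero (allFin m))) (ℕP.+-identityʳ (h zero)))
  ∑-indicator {suc m} (suc a) h = trans (∑-allFin-suc (λ r → ⟦ does (suc a Fin.≟ r) ⟧ * h r))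
    (∑-indicator a (λ r → h (suc r)))

  ∑-content : ∀ (w : List (Fin m)) (h : Fin m → ℕ) → ∑[ a ∈ w ] h a ≡ ∑[ r ∈ allFin m ] (lookup (content w) r * h r)
  ∑-content {m} [] h = sym (trans (∑-cong (allFin m) (λ r → cong (_* h r) (VecP.lookup-replicate r 0))) (∑-zero (allFin m)))
  ∑-content {m} (a ∷ w) h = begin
    h a + ∑[ b ∈ w ] h b
      ≡⟨ cong₂ _+_ (∑-indicator a h) (sym (∑-content w h)) ⟨
    ∑[ r ∈ allFin m ] (⟦ does (a Fin.≟ r) ⟧ * h r) + ∑[ r ∈ allFin m ] (lookup (content w) r * h r)
      ≡⟨ ∑-+ (λ r → ⟦ does (a Fin.≟ r) ⟧ * h r) (λ r → lookup (content w) r * h r) (allFin m) ⟨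
    ∑[ r ∈ allFin m ] (⟦ does (a Fin.≟ r) ⟧ * h r + lookup (content w) r * h r)
      ≡⟨ ∑-cong (allFin m) (λ r → trans (sym (ℕP.*-distribʳ-+ (h r) ⟦ does (a Fin.≟ r) ⟧ (lookup (content w) r)))
           (cong (_* h r) (sym (trans (VecP.lookup-zipWith _+_ r (𝕖 a) (content w)) (cong (_+ _) (lookup-𝕖 a r)))))) ⟩
    ∑[ r ∈ allFin m ] (lookup (content (a ∷ w)) r * h r) ∎
    where open ≡-Reasoning

module PowerSeries (k : ℕ) where
  open import Defs using (vecLeᵇ)
  open Counting using (sumOver; ∑-allFin-suc)
  open MultiIndex
  open import Data.Bool using (true; false; _∧_; if_then_else_)
  open import Data.Nat using (ℕ; zero; suc)
  open import Data.Integer as ℤ using (ℤ; 0ℤ; 1ℤ; _+_; _*_; -_)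
  import Data.Integer.Properties as ℤP
  open import Data.Fin using (Fin; zero; suc)
  open import Data.Vec using (Vec)
  open import Data.List using (List; []; _∷_; _++_; map; concatMap; allFin)
  open import Data.Product using (Σ; _×_; _,_)
  open import Algebra.Bundles using (AbelianGroup; CommutativeMonoid)
  open import Algebra.Construct.Pointwise (Vec ℕ k) using (abelianGroup)
  open import Relation.Nullary using (¬_)
  open import Relation.Binary.PropositionalEquality using (_≡_; _≗_; refl; sym; trans; cong; cong₂)

  PowerSeries : Set
  PowerSeries = Vec ℕ k → ℤ

  seriesGroup : AbelianGroup _ _
  seriesGroup = abelianGroup ℤP.+-0-abelianGroup

  open AbelianGroup seriesGroup public
    using (setoid; commutativeMonoid)
    renaming (_∙_ to infixl 6 _⊕_; ε to 𝟘; _⁻¹ to ⊖_; ∙-cong to ⊕-cong; assoc to ⊕-assoc; identityʳ to ⊕-identityʳ)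
  open import Algebra.Properties.CommutativeMonoid.Sum commutativeMonoid public using (sum-syntax)
  open import Algebra.Properties.CommutativeSemigroup (CommutativeMonoid.commutativeSemigroup commutativeMonoid)
    using (interchange)
  open import Algebra.Properties.AbelianGroup seriesGroup using (⁻¹-∙-comm)
  open import Relation.Binary.Reasoning.Setoid setoid

  𝟙 : PowerSeries
  𝟙 v = if 0ᵛ ≟ᵛ v then 1ℤ else 0ℤ

  Term Polynomial : Set
  Term       = ℤ × Vec ℕ k
  Polynomial = List Term

  infixr 7 _◃_ _⊙_
  infixl 8 _⊗_
  infixl 6 _⊝_

  _◃_ : Term → PowerSeries → PowerSeries
  ((c , e) ◃ G) v = if vecLeᵇ e v then c * G (v ∸ᵛ e) else 0ℤ

  _⊙_ : Polynomial → PowerSeries → PowerSeries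
  []      ⊙ G = 𝟘
  (t ∷ P) ⊙ G = t ◃ G ⊕ P ⊙ G

  _·ᵗ_ : Term → Term → Term
  (c , α) ·ᵗ (d , β) = (c * d , α +ᵛ β)

  _⊗_ : Polynomial → Polynomial → Polynomial
  P ⊗ Q = concatMap (λ t → map (t ·ᵗ_) Q) P

  neg : Term → Term
  neg (c , e) = (- c , e)

  _⊝_ : Polynomial → Polynomial → Polynomial
  P ⊝ Q = P ++ map neg Q

  1ᵖ : Polynomial
  1ᵖ = (1ℤ , 0ᵛ) ∷ []

  ∑ᵖ : ∀ {n} → (Fin n → Polynomial) → Polynomial
  ∑ᵖ {zero}  P = []
  ∑ᵖ {suc n} P = P zero ++ ∑ᵖ (λ j → P (suc j))

  cst : Polynomial → ℤ
  cst P = (P ⊙ 𝟙) 0ᵛ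

  Rational : PowerSeries → Set
  Rational F = Σ Polynomial λ P → Σ Polynomial λ Q → ¬ cst Q ≡ 0ℤ × Q ⊙ F ≗ P ⊙ 𝟙

  ⊕-congˡ : ∀ F {G H} → G ≗ H → F ⊕ G ≗ F ⊕ H
  ⊕-congˡ F G≗H v = cong (F v +_) (G≗H v)

  ◃-cong : ∀ t {F G} → F ≗ G → t ◃ F ≗ t ◃ G
  ◃-cong (c , e) F≗G v = cong (λ x → if vecLeᵇ e v then c * x else 0ℤ) (F≗G _)

  ◃-⊕ : ∀ t F G → t ◃ (F ⊕ G) ≗ t ◃ F ⊕ t ◃ G
  ◃-⊕ (c , e) F G v with vecLeᵇ e v
  ... | true  = ℤP.*-distribˡ-+ c _ _
  ... | false = refl

  ◃-𝟘 : ∀ t → t ◃ 𝟘 ≗ 𝟘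
  ◃-𝟘 (c , e) v with vecLeᵇ e v
  ... | true  = ℤP.*-zeroʳ c
  ... | false = refl

  neg-◃ : ∀ t G → neg t ◃ G ≗ ⊖ (t ◃ G)
  neg-◃ (c , e) G v with vecLeᵇ e v
  ... | true  = sym (ℤP.neg-distribˡ-* c _)
  ... | false = refl

  ◃-◃ : ∀ s t G → s ◃ t ◃ G ≗ (s ·ᵗ t) ◃ G
  ◃-◃ (c , α) (d , β) G v rewrite vecLeᵇ-+ᵛ α β v | sym (∸ᵛ-+ᵛ v α β)
    with vecLeᵇ α v | vecLeᵇ β (v ∸ᵛ α)
  ... | false | _     = refl
  ... | true  | false = ℤP.*-zeroʳ c
  ... | true  | true  = sym (ℤP.*-assoc c d _)

  ·ᵗ-comm : ∀ s t → s ·ᵗ t ≡ t ·ᵗ s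
  ·ᵗ-comm (c , α) (d , β) = cong₂ _,_ (ℤP.*-comm c d) (+ᵛ-comm α β)

  ◃-comm : ∀ s t G → s ◃ t ◃ G ≗ t ◃ s ◃ G
  ◃-comm s t G = begin
    s ◃ t ◃ G      ≈⟨ ◃-◃ s t G ⟩
    (s ·ᵗ t) ◃ G   ≡⟨ cong (_◃ G) (·ᵗ-comm s t) ⟩
    (t ·ᵗ s) ◃ G   ≈⟨ ◃-◃ t s G ⟨
    t ◃ s ◃ G      ∎

  ⊙-cong : ∀ P {F G} → F ≗ G → P ⊙ F ≗ P ⊙ G
  ⊙-cong []      F≗G v = refl
  ⊙-cong (t ∷ P) F≗G v = cong₂ _+_ (◃-cong t F≗G v) (⊙-cong P F≗G v)

  ⊙-⊕ : ∀ P F G → P ⊙ (F ⊕ G) ≗ P ⊙ F ⊕ P ⊙ G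
  ⊙-⊕ []      F G v = refl
  ⊙-⊕ (t ∷ P) F G = begin
    t ◃ (F ⊕ G) ⊕ P ⊙ (F ⊕ G)             ≈⟨ ⊕-cong (◃-⊕ t F G) (⊙-⊕ P F G) ⟩
    (t ◃ F ⊕ t ◃ G) ⊕ (P ⊙ F ⊕ P ⊙ G)     ≈⟨ interchange (t ◃ F) (t ◃ G) (P ⊙ F) (P ⊙ G) ⟩
    (t ◃ F ⊕ P ⊙ F) ⊕ (t ◃ G ⊕ P ⊙ G)     ∎

  ⊙-𝟘 : ∀ P → P ⊙ 𝟘 ≗ 𝟘
  ⊙-𝟘 []      v = refl
  ⊙-𝟘 (t ∷ P) v = cong₂ _+_ (◃-𝟘 t v) (⊙-𝟘 P v)

  ⊙-++ : ∀ P Q G → (P ++ Q) ⊙ G ≗ P ⊙ G ⊕ Q ⊙ G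
  ⊙-++ []      Q G v = sym (ℤP.+-identityˡ _)
  ⊙-++ (t ∷ P) Q G = begin
    t ◃ G ⊕ (P ++ Q) ⊙ G        ≈⟨ ⊕-congˡ (t ◃ G) (⊙-++ P Q G) ⟩
    t ◃ G ⊕ (P ⊙ G ⊕ Q ⊙ G)     ≈⟨ ⊕-assoc (t ◃ G) (P ⊙ G) (Q ⊙ G) ⟨
    t ◃ G ⊕ P ⊙ G ⊕ Q ⊙ G       ∎

  ⊙-neg : ∀ Q G → map neg Q ⊙ G ≗ ⊖ (Q ⊙ G)
  ⊙-neg []      G v = refl
  ⊙-neg (t ∷ Q) G = begin
    neg t ◃ G ⊕ map neg Q ⊙ G   ≈⟨ ⊕-cong (neg-◃ t G) (⊙-neg Q G) ⟩
    ⊖ (t ◃ G) ⊕ ⊖ (Q ⊙ G)       ≈⟨ ⁻¹-∙-comm (t ◃ G) (Q ⊙ G) ⟩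
    ⊖ (t ◃ G ⊕ Q ⊙ G)           ∎

  ⊙-⊝ : ∀ P Q G → (P ⊝ Q) ⊙ G ≗ P ⊙ G ⊕ ⊖ (Q ⊙ G)
  ⊙-⊝ P Q G = begin
    (P ⊝ Q) ⊙ G                 ≈⟨ ⊙-++ P (map neg Q) G ⟩
    P ⊙ G ⊕ map neg Q ⊙ G       ≈⟨ ⊕-congˡ (P ⊙ G) (⊙-neg Q G) ⟩
    P ⊙ G ⊕ ⊖ (Q ⊙ G)           ∎

  ⊙-map-·ᵗ : ∀ t Q G → map (t ·ᵗ_) Q ⊙ G ≗ t ◃ Q ⊙ G
  ⊙-map-·ᵗ t []      G v = sym (◃-𝟘 t v)
  ⊙-map-·ᵗ t (s ∷ Q) G = begin
    (t ·ᵗ s) ◃ G ⊕ map (t ·ᵗ_) Q ⊙ G   ≈⟨ ⊕-cong (λ v → sym (◃-◃ t s G v)) (⊙-map-·ᵗ t Q G) ⟩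
    t ◃ s ◃ G ⊕ t ◃ Q ⊙ G             ≈⟨ ◃-⊕ t (s ◃ G) (Q ⊙ G) ⟨
    t ◃ (s ◃ G ⊕ Q ⊙ G)               ∎

  ⊙-⊗ : ∀ P Q G → P ⊗ Q ⊙ G ≗ P ⊙ Q ⊙ G
  ⊙-⊗ []      Q G v = refl
  ⊙-⊗ (t ∷ P) Q G = begin
    (map (t ·ᵗ_) Q ++ P ⊗ Q) ⊙ G          ≈⟨ ⊙-++ (map (t ·ᵗ_) Q) (P ⊗ Q) G ⟩
    map (t ·ᵗ_) Q ⊙ G ⊕ P ⊗ Q ⊙ G         ≈⟨ ⊕-cong (⊙-map-·ᵗ t Q G) (⊙-⊗ P Q G) ⟩
    t ◃ Q ⊙ G ⊕ P ⊙ Q ⊙ G                 ∎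

  ◃-⊙ : ∀ t Q G → t ◃ Q ⊙ G ≗ Q ⊙ t ◃ G
  ◃-⊙ t []      G = ◃-𝟘 t
  ◃-⊙ t (s ∷ Q) G = begin
    t ◃ (s ◃ G ⊕ Q ⊙ G)         ≈⟨ ◃-⊕ t (s ◃ G) (Q ⊙ G) ⟩
    t ◃ s ◃ G ⊕ t ◃ Q ⊙ G       ≈⟨ ⊕-cong (◃-comm t s G) (◃-⊙ t Q G) ⟩
    s ◃ t ◃ G ⊕ Q ⊙ t ◃ G       ∎

  ⊙-comm : ∀ P Q G → P ⊙ Q ⊙ G ≗ Q ⊙ P ⊙ G
  ⊙-comm []      Q G v = sym (⊙-𝟘 Q v)
  ⊙-comm (t ∷ P) Q G = begin
    t ◃ Q ⊙ G ⊕ P ⊙ Q ⊙ G       ≈⟨ ⊕-cong (◃-⊙ t Q G) (⊙-comm P Q G) ⟩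
    Q ⊙ t ◃ G ⊕ Q ⊙ P ⊙ G       ≈⟨ ⊙-⊕ Q (t ◃ G) (P ⊙ G) ⟨
    Q ⊙ (t ◃ G ⊕ P ⊙ G)         ∎

  ⊙-∑ : ∀ P {n} (G : Fin n → PowerSeries) → P ⊙ ∑[ j < n ] G j ≗ ∑[ j < n ] (P ⊙ G j)
  ⊙-∑ P {zero}  G = ⊙-𝟘 P
  ⊙-∑ P {suc n} G = begin
    P ⊙ (G zero ⊕ ∑[ j < n ] G (suc j))            ≈⟨ ⊙-⊕ P (G zero) (∑[ j < n ] G (suc j)) ⟩
    P ⊙ G zero ⊕ P ⊙ ∑[ j < n ] G (suc j)          ≈⟨ ⊕-congˡ (P ⊙ G zero) (⊙-∑ P (λ j → G (suc j))) ⟩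
    P ⊙ G zero ⊕ ∑[ j < n ] (P ⊙ G (suc j))          ∎

  1ᵖ-⊙ : ∀ G → 1ᵖ ⊙ G ≗ G
  1ᵖ-⊙ G v rewrite vecLeᵇ-0ᵛ v | ∸ᵛ-0ᵛ v = trans (ℤP.+-identityʳ _) (ℤP.*-identityˡ _)

  𝟙-0ᵛ : 𝟙 0ᵛ ≡ 1ℤ
  𝟙-0ᵛ rewrite ≟ᵛ-refl (0ᵛ {k}) = refl

  ⊙-at-0ᵛ : ∀ P G → (P ⊙ G) 0ᵛ ≡ cst P * G 0ᵛ
  ⊙-at-0ᵛ []            G = refl
  ⊙-at-0ᵛ ((c , e) ∷ P) G rewrite 0ᵛ-∸ᵛ e | 𝟙-0ᵛ | ⊙-at-0ᵛ P G | ℤP.*-identityʳ c with vecLeᵇ e 0ᵛ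
  ... | true  = sym (ℤP.*-distribʳ-+ (G 0ᵛ) c (cst P))
  ... | false = sym (ℤP.*-distribʳ-+ (G 0ᵛ) 0ℤ (cst P))

  cst-⊗ : ∀ P Q → cst (P ⊗ Q) ≡ cst P * cst Q
  cst-⊗ P Q = trans (⊙-⊗ P Q 𝟙 0ᵛ) (⊙-at-0ᵛ P (Q ⊙ 𝟙))

  cst-1ᵖ : cst 1ᵖ ≡ 1ℤ
  cst-1ᵖ = trans (1ᵖ-⊙ 𝟙 0ᵛ) 𝟙-0ᵛ

  cst-++ : ∀ P Q → cst (P ++ Q) ≡ cst P + cst Q
  cst-++ P Q = ⊙-++ P Q 𝟙 0ᵛ

  cst-⊝-cst≡0 : ∀ P Q → cst Q ≡ 0ℤ → cst (P ⊝ Q) ≡ cst P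
  cst-⊝-cst≡0 P Q cstQ≡0 = trans (⊙-⊝ P Q 𝟙 0ᵛ) (trans (cong (λ c → cst P + - c) cstQ≡0) (ℤP.+-identityʳ (cst P)))

  ⊙-∑ᵖ : ∀ {n} (P : Fin n → Polynomial) G → ∑ᵖ P ⊙ G ≗ ∑[ j < n ] (P j ⊙ G)
  ⊙-∑ᵖ {zero}  P G v = refl
  ⊙-∑ᵖ {suc n} P G = begin
    (P zero ++ ∑ᵖ (λ j → P (suc j))) ⊙ G          ≈⟨ ⊙-++ (P zero) (∑ᵖ (λ j → P (suc j))) G ⟩
    P zero ⊙ G ⊕ ∑ᵖ (λ j → P (suc j)) ⊙ G         ≈⟨ ⊕-congˡ (P zero ⊙ G) (⊙-∑ᵖ (λ j → P (suc j)) G) ⟩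
    P zero ⊙ G ⊕ ∑[ j < n ] (P (suc j) ⊙ G)       ∎

  ∑-at : ∀ {n} (g : Fin n → PowerSeries) (h : Fin n → ℕ) v →
         (∀ j → g j v ≡ ℤ.+ h j) → (∑[ j < n ] g j) v ≡ ℤ.+ ∑[ j ∈ allFin n ] h j
  ∑-at {zero}  g h v eq = refl
  ∑-at {suc n} g h v eq = trans
    (cong₂ _+_ (eq zero) (∑-at (λ j → g (suc j)) (λ j → h (suc j)) v (λ j → eq (suc j))))
    (trans (sym (ℤP.pos-+ (h zero) _)) (cong ℤ.+_ (sym (∑-allFin-suc h))))

  ∑-at-zero : ∀ {n} (g : Fin n → PowerSeries) v → (∀ j → g j v ≡ 0ℤ) → (∑[ j < n ] g j) v ≡ 0ℤ
  ∑-at-zero {n} g v eq = trans (∑-at g (λ _ → 0) v eq) (cong ℤ.+_ (Counting.∑-zero (allFin n)))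

  ◃-𝟙 : ∀ c e v → ((c , e) ◃ 𝟙) v ≡ (if e ≟ᵛ v then c else 0ℤ)
  ◃-𝟙 c e v = trans (lemma (vecLeᵇ e v) (0ᵛ ≟ᵛ v ∸ᵛ e))
    (cong (if_then c else 0ℤ) (trans (sym (+ᵛ-≟ᵛ e 0ᵛ v)) (cong (_≟ᵛ v) (+ᵛ-identityʳ e))))
    where
    lemma : ∀ b z → (if b then c * (if z then 1ℤ else 0ℤ) else 0ℤ) ≡ (if b ∧ z then c else 0ℤ)
    lemma false z     = refl
    lemma true  true  = ℤP.*-identityʳ c
    lemma true  false = ℤP.*-zeroʳ c

module Elimination (k : ℕ) where
  open PowerSeries k
  open import Data.Nat using (ℕ; zero; suc)
  open import Data.Fin using (Fin; zero; suc)
  open import Data.Maybe using (Maybe; just; nothing) renaming (map to mapMaybe)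
  open import Data.List using (_++_)
  open import Data.Product using (_,_)
  open import Data.Sum using ([_,_]′)
  open import Data.Integer using (ℤ; 0ℤ; _+_; _*_; -_)
  import Data.Integer.Properties as ℤP
  open import Data.Integer.Tactic.RingSolver using (solve-∀)
  open import Function using (_∘_)
  open import Relation.Nullary using (¬_)
  open import Relation.Binary.PropositionalEquality using (_≡_; _≗_; refl; trans; cong)
  open import Algebra.Bundles using (CommutativeMonoid)
  open import Algebra.Properties.CommutativeMonoid.Sum commutativeMonoid using (∑-distrib-+; sum-cong-≋)
  open import Algebra.Properties.CommutativeSemigroup (CommutativeMonoid.commutativeSemigroup commutativeMonoid)
    using (interchange; x∙yz≈y∙xz)
  open import Relation.Binary.Reasoning.Setoid setoid

  ∑ᴹ : ∀ {n} → (Maybe (Fin n) → PowerSeries) → PowerSeries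
  ∑ᴹ {n} g = g nothing ⊕ ∑[ j < n ] g (just j)

  record LinearSystem (n : ℕ) (G : Maybe (Fin n) → PowerSeries) : Set where
    field
      D b      : Maybe (Fin n) → Polynomial
      M        : Maybe (Fin n) → Maybe (Fin n) → Polynomial
      cst-D≢0  : ∀ i → ¬ cst (D i) ≡ 0ℤ
      cst-M≡0  : ∀ i j → cst (M i j) ≡ 0ℤ
      equation : ∀ i → D i ⊙ G i ≗ b i ⊙ 𝟙 ⊕ ∑ᴹ (λ j → M i j ⊙ G j)

  ∑ᴹ-cong : ∀ {n} {g h : Maybe (Fin n) → PowerSeries} → (∀ j → g j ≗ h j) → ∑ᴹ g ≗ ∑ᴹ h
  ∑ᴹ-cong g≗h = ⊕-cong (g≗h nothing) (sum-cong-≋ (g≗h ∘ just))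

  ∑ᴹ-distrib-⊕ : ∀ {n} (g h : Maybe (Fin n) → PowerSeries) → ∑ᴹ (λ j → g j ⊕ h j) ≗ ∑ᴹ g ⊕ ∑ᴹ h
  ∑ᴹ-distrib-⊕ {n} g h = begin
    (g nothing ⊕ h nothing) ⊕ ∑[ j < n ] (g (just j) ⊕ h (just j))
      ≈⟨ ⊕-congˡ (g nothing ⊕ h nothing) (∑-distrib-+ (g ∘ just) (h ∘ just)) ⟩
    (g nothing ⊕ h nothing) ⊕ (∑[ j < n ] g (just j) ⊕ ∑[ j < n ] h (just j))
      ≈⟨ interchange (g nothing) (h nothing) _ _ ⟩
    ∑ᴹ g ⊕ ∑ᴹ h ∎

  ⊙-∑ᴹ : ∀ P {n} (g : Maybe (Fin n) → PowerSeries) → P ⊙ ∑ᴹ g ≗ ∑ᴹ (λ j → P ⊙ g j)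
  ⊙-∑ᴹ P {n} g = begin
    P ⊙ (g nothing ⊕ ∑[ j < n ] g (just j))      ≈⟨ ⊙-⊕ P (g nothing) (∑[ j < n ] g (just j)) ⟩
    P ⊙ g nothing ⊕ P ⊙ ∑[ j < n ] g (just j)    ≈⟨ ⊕-congˡ (P ⊙ g nothing) (⊙-∑ P (g ∘ just)) ⟩
    ∑ᴹ (λ j → P ⊙ g j)                          ∎

  ∑ᴹ-pivot : ∀ {n} (g : Maybe (Fin (suc n)) → PowerSeries) →
             ∑ᴹ g ≗ g (just zero) ⊕ ∑ᴹ (g ∘ mapMaybe suc)
  ∑ᴹ-pivot g = x∙yz≈y∙xz (g nothing) (g (just zero)) _

  isolate : ∀ D M b R G → D ⊙ G ≗ b ⊙ 𝟙 ⊕ (M ⊙ G ⊕ R) → (D ⊝ M) ⊙ G ≗ b ⊙ 𝟙 ⊕ R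
  isolate D M b R G eq = begin
    (D ⊝ M) ⊙ G                          ≈⟨ ⊙-⊝ D M G ⟩
    D ⊙ G ⊕ ⊖ (M ⊙ G)                    ≈⟨ ⊕-cong eq (λ _ → refl) ⟩
    (b ⊙ 𝟙 ⊕ (M ⊙ G ⊕ R)) ⊕ ⊖ (M ⊙ G)    ≈⟨ (λ v → cancel ((b ⊙ 𝟙) v) ((M ⊙ G) v) (R v)) ⟩
    b ⊙ 𝟙 ⊕ R                            ∎
    where
    cancel : ∀ x y z → (x + (y + z)) + - y ≡ x + z
    cancel = solve-∀

  ⊙-⊗-++ : ∀ A B C E H → (A ⊗ B ++ C ⊗ E) ⊙ H ≗ A ⊙ B ⊙ H ⊕ C ⊙ E ⊙ H
  ⊙-⊗-++ A B C E H = begin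
    (A ⊗ B ++ C ⊗ E) ⊙ H          ≈⟨ ⊙-++ (A ⊗ B) (C ⊗ E) H ⟩
    A ⊗ B ⊙ H ⊕ C ⊗ E ⊙ H         ≈⟨ ⊕-cong (⊙-⊗ A B H) (⊙-⊗ C E H) ⟩
    A ⊙ B ⊙ H ⊕ C ⊙ E ⊙ H         ∎

  *-≢0 : ∀ {x y : ℤ} → ¬ x ≡ 0ℤ → ¬ y ≡ 0ℤ → ¬ x * y ≡ 0ℤ
  *-≢0 {x} x≢0 y≢0 xy≡0 = [ x≢0 , y≢0 ]′ (ℤP.i*j≡0⇒i≡0∨j≡0 x xy≡0)

  -- Eliminating the unknown p = just zero: the equation of p reads E G_p = b_p + rest_p with E = D_p − M_pp;
  -- every other equation is multiplied by E, and E G_p is replaced by the right-hand side.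
  module _ {n} {G : Maybe (Fin (suc n)) → PowerSeries} (S : LinearSystem (suc n) G) where
    open LinearSystem S

    private
      p : Maybe (Fin (suc n))
      p = just zero

      lift : Maybe (Fin n) → Maybe (Fin (suc n))
      lift = mapMaybe suc

      E : Polynomial
      E = D p ⊝ M p p

      rest : Maybe (Fin (suc n)) → PowerSeries
      rest i = ∑ᴹ (λ j → M i (lift j) ⊙ G (lift j))

      pivot-row : E ⊙ G p ≗ b p ⊙ 𝟙 ⊕ rest p
      pivot-row = isolate (D p) (M p p) (b p) (rest p) (G p)
        (λ v → trans (equation p v) (⊕-congˡ (b p ⊙ 𝟙) (∑ᴹ-pivot (λ j → M p j ⊙ G j)) v))

      substitute : ∀ N → E ⊙ N ⊙ G p ≗ N ⊙ b p ⊙ 𝟙 ⊕ N ⊙ rest p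
      substitute N = begin
        E ⊙ N ⊙ G p                    ≈⟨ ⊙-comm E N (G p) ⟩
        N ⊙ E ⊙ G p                    ≈⟨ ⊙-cong N pivot-row ⟩
        N ⊙ (b p ⊙ 𝟙 ⊕ rest p)         ≈⟨ ⊙-⊕ N (b p ⊙ 𝟙) (rest p) ⟩
        N ⊙ b p ⊙ 𝟙 ⊕ N ⊙ rest p       ∎

      D′ b′ : Maybe (Fin n) → Polynomial
      D′ i = E ⊗ D (lift i)
      b′ i = E ⊗ b (lift i) ++ M (lift i) p ⊗ b p

      M′ : Maybe (Fin n) → Maybe (Fin n) → Polynomial
      M′ i j = E ⊗ M (lift i) (lift j) ++ M (lift i) p ⊗ M p (lift j)

      cst-E : cst E ≡ cst (D p)
      cst-E = cst-⊝-cst≡0 (D p) (M p p) (cst-M≡0 p p)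

      cst-D′≢0 : ∀ i → ¬ cst (D′ i) ≡ 0ℤ
      cst-D′≢0 i rewrite cst-⊗ E (D (lift i)) | cst-E = *-≢0 (cst-D≢0 p) (cst-D≢0 (lift i))

      cst-M′≡0 : ∀ i j → cst (M′ i j) ≡ 0ℤ
      cst-M′≡0 i j rewrite cst-++ (E ⊗ M (lift i) (lift j)) (M (lift i) p ⊗ M p (lift j))
        | cst-⊗ E (M (lift i) (lift j)) | cst-⊗ (M (lift i) p) (M p (lift j))
        | cst-M≡0 (lift i) (lift j) | cst-M≡0 (lift i) p = cong (_+ 0ℤ) (ℤP.*-zeroʳ (cst E))

      new-rhs : ∀ i → b′ i ⊙ 𝟙 ⊕ ∑ᴹ (λ j → M′ i j ⊙ G (lift j))
                    ≗ (E ⊙ b (lift i) ⊙ 𝟙 ⊕ M (lift i) p ⊙ b p ⊙ 𝟙) ⊕ (E ⊙ rest (lift i) ⊕ M (lift i) p ⊙ rest p)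
      new-rhs i = ⊕-cong (⊙-⊗-++ E (b (lift i)) (M (lift i) p) (b p) 𝟙) (begin
        ∑ᴹ (λ j → M′ i j ⊙ G (lift j))
          ≈⟨ ∑ᴹ-cong (λ j → ⊙-⊗-++ E (M (lift i) (lift j)) (M (lift i) p) (M p (lift j)) (G (lift j))) ⟩
        ∑ᴹ (λ j → E ⊙ gᵢ j ⊕ M (lift i) p ⊙ gₚ j)
          ≈⟨ ∑ᴹ-distrib-⊕ (λ j → E ⊙ gᵢ j) (λ j → M (lift i) p ⊙ gₚ j) ⟩
        ∑ᴹ (λ j → E ⊙ gᵢ j) ⊕ ∑ᴹ (λ j → M (lift i) p ⊙ gₚ j)
          ≈⟨ ⊕-cong (⊙-∑ᴹ E gᵢ) (⊙-∑ᴹ (M (lift i) p) gₚ) ⟨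
        E ⊙ rest (lift i) ⊕ M (lift i) p ⊙ rest p ∎)
        where
        gᵢ gₚ : Maybe (Fin n) → PowerSeries
        gᵢ j = M (lift i) (lift j) ⊙ G (lift j)
        gₚ j = M p (lift j) ⊙ G (lift j)

      equation′ : ∀ i → D′ i ⊙ G (lift i) ≗ b′ i ⊙ 𝟙 ⊕ ∑ᴹ (λ j → M′ i j ⊙ G (lift j))
      equation′ i = begin
        E ⊗ D I ⊙ G I
          ≈⟨ ⊙-⊗ E (D I) (G I) ⟩
        E ⊙ D I ⊙ G I
          ≈⟨ ⊙-cong E (equation I) ⟩
        E ⊙ (b I ⊙ 𝟙 ⊕ ∑ᴹ (λ j → M I j ⊙ G j))
          ≈⟨ ⊙-cong E (⊕-congˡ (b I ⊙ 𝟙) (∑ᴹ-pivot (λ j → M I j ⊙ G j))) ⟩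
        E ⊙ (b I ⊙ 𝟙 ⊕ (M I p ⊙ G p ⊕ rest I))
          ≈⟨ ⊙-⊕ E (b I ⊙ 𝟙) _ ⟩
        E ⊙ b I ⊙ 𝟙 ⊕ E ⊙ (M I p ⊙ G p ⊕ rest I)
          ≈⟨ ⊕-congˡ (E ⊙ b I ⊙ 𝟙) (⊙-⊕ E (M I p ⊙ G p) (rest I)) ⟩
        E ⊙ b I ⊙ 𝟙 ⊕ (E ⊙ M I p ⊙ G p ⊕ E ⊙ rest I)
          ≈⟨ ⊕-congˡ (E ⊙ b I ⊙ 𝟙) (⊕-cong (substitute (M I p)) (λ _ → refl)) ⟩
        E ⊙ b I ⊙ 𝟙 ⊕ ((M I p ⊙ b p ⊙ 𝟙 ⊕ M I p ⊙ rest p) ⊕ E ⊙ rest I)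
          ≈⟨ (λ v → regroup ((E ⊙ b I ⊙ 𝟙) v) ((M I p ⊙ b p ⊙ 𝟙) v)
                            ((M I p ⊙ rest p) v) ((E ⊙ rest I) v)) ⟩
        (E ⊙ b I ⊙ 𝟙 ⊕ M I p ⊙ b p ⊙ 𝟙) ⊕ (E ⊙ rest I ⊕ M I p ⊙ rest p)
          ≈⟨ new-rhs i ⟨
        b′ i ⊙ 𝟙 ⊕ ∑ᴹ (λ j → M′ i j ⊙ G (lift j)) ∎
        where
        I = lift i
        regroup : ∀ a b c d → a + ((b + c) + d) ≡ (a + b) + (d + c)
        regroup = solve-∀

    eliminate : LinearSystem n (G ∘ lift)
    eliminate = record
      { D = D′ ; b = b′ ; M = M′
      ; cst-D≢0 = cst-D′≢0 ; cst-M≡0 = cst-M′≡0 ; equation = equation′ }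

  linearSystem⇒rational : ∀ {n G} → LinearSystem n G → Rational (G nothing)
  linearSystem⇒rational {zero} S = b nothing , D nothing ⊝ M nothing nothing , cst≢0 , eq
    where
    open LinearSystem S
    cst≢0 : ¬ cst (D nothing ⊝ M nothing nothing) ≡ 0ℤ
    cst≢0 rewrite cst-⊝-cst≡0 (D nothing) (M nothing nothing) (cst-M≡0 nothing nothing) = cst-D≢0 nothing
    eq : (D nothing ⊝ M nothing nothing) ⊙ _ ≗ b nothing ⊙ 𝟙
    eq v = trans (isolate (D nothing) (M nothing nothing) (b nothing) 𝟘 _ (equation nothing) v)
                 (⊕-identityʳ (b nothing ⊙ 𝟙) v)
  linearSystem⇒rational {suc n} S = linearSystem⇒rational (eliminate S)

module CurriedSeries {m : ℕ} where
  open import Data.Nat using (ℕ; suc)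
  open import Defs using (Series; mulCoeff; polyCoeff; IsRational)
  open PowerSeries (suc m)
  open MultiIndex using (0ᵛ)
  open import Data.Integer using (ℤ; _+_)
  open import Data.Vec using (Vec; _∷_)
  open import Data.List using ([]; _∷_; map)
  open import Data.Product using (_×_; _,_)
  open import Relation.Binary.PropositionalEquality using (_≡_; refl; sym; trans; cong; cong₂)

  uncurryˢ : Series m → PowerSeries
  uncurryˢ F (n ∷ ℓ) = F n ℓ

  splitTerm : Term → ℤ × ℕ × Vec ℕ m
  splitTerm (c , a ∷ α) = c , a , α

  mulCoeff-⊙ : ∀ P F n ℓ → mulCoeff (map splitTerm P) F n ℓ ≡ (P ⊙ uncurryˢ F) (n ∷ ℓ)
  mulCoeff-⊙ []                  F n ℓ = refl
  mulCoeff-⊙ ((c , a ∷ α) ∷ P) F n ℓ = cong (((c , a ∷ α) ◃ uncurryˢ F) (n ∷ ℓ) +_) (mulCoeff-⊙ P F n ℓ)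

  polyCoeff-⊙𝟙 : ∀ P n ℓ → polyCoeff (map splitTerm P) n ℓ ≡ (P ⊙ 𝟙) (n ∷ ℓ)
  polyCoeff-⊙𝟙 []                  n ℓ = refl
  polyCoeff-⊙𝟙 ((c , a ∷ α) ∷ P) n ℓ = cong₂ _+_ (sym (◃-𝟙 c (a ∷ α) (n ∷ ℓ))) (polyCoeff-⊙𝟙 P n ℓ)

  rational⇒isRational : ∀ F → Rational (uncurryˢ F) → IsRational F
  rational⇒isRational F (P , Q , cstQ≢0 , Q⊙F≗P) =
    map splitTerm P , map splitTerm Q ,
    (λ cst≡0 → cstQ≢0 (trans (sym (polyCoeff-⊙𝟙 Q 0 0ᵛ)) cst≡0)) ,
    (λ n ℓ → trans (mulCoeff-⊙ Q F n ℓ) (trans (Q⊙F≗P (n ∷ ℓ)) (sym (polyCoeff-⊙𝟙 P n ℓ))))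

module HWalks {m : ℕ} (f : Fin m → Fin m → Bool) where
  open import Data.Nat as ℕ using (ℕ; zero; suc)
  open import Defs using (genF; AH; isHWalk; hasContent; words; vecLeᵇ)
  open Counting
  open MultiIndex
  open Content
  open PowerSeries (suc m)
  open Elimination (suc m)
  open CurriedSeries using (uncurryˢ)
  import Data.Nat.Properties as ℕP
  open import Data.Fin using (Fin; zero; suc)
  open import Data.Bool using (Bool; true; false; _∧_; not; if_then_else_)
  open import Data.Bool.Properties using (∧-assoc; ∧-zeroʳ; ∧-identityʳ; if-float; if-not)
  open import Data.Integer as ℤ using (ℤ; 0ℤ; 1ℤ; _+_)
  import Data.Integer.Properties as ℤP
  open import Data.Vec as Vec using (Vec; _∷_)
  open import Data.List using (List; []; _∷_; allFin; length)
  open import Data.Maybe using (Maybe; just; nothing)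
  open import Data.Product using (_,_)
  open import Function using (case_of_)
  open import Relation.Nullary using (does; yes; no; Dec)
  open import Relation.Nullary.Negation using (contradiction)
  open import Relation.Binary.PropositionalEquality using (_≡_; _≢_; _≗_; refl; sym; trans; cong; module ≡-Reasoning)
  open import Algebra.Properties.CommutativeMonoid.Sum commutativeMonoid using (∑-distrib-+; ∑-comm; sum-cong-≋)
  import Relation.Binary.Reasoning.Setoid setoid as ≈-Reasoning

  letters : List (Fin m)
  letters = allFin m

  F : PowerSeries
  F = uncurryˢ (genF f)

  -- the monomial x·y_s (exponent vectors list the power of x first)
  z : Fin m → Term
  z s = (1ℤ , 1 ∷ 𝕖 s)

  edge : Fin m → Fin m → Polynomial
  edge s t = if f s t then [] else z s ∷ []

  walkOf : Vec ℕ m → List (Fin m) → Bool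
  walkOf ℓ w = hasContent ℓ w ∧ isHWalk f w

  -- walksFrom s n ℓ counts the H-walks s w₁ ⋯ wₙ of content ℓ, the coefficient of x^(n+1) y^ℓ in Walk s.
  walksFrom : Fin m → ℕ → Vec ℕ m → ℕ
  walksFrom s n ℓ = count (λ w → walkOf ℓ (s ∷ w)) (words letters n)

  continuations : Fin m → ℕ → Vec ℕ m → ℕ
  continuations s n ℓ = count (λ w → hasContent ℓ w ∧ isHWalk f (s ∷ w)) (words letters n)

  Walk : Fin m → PowerSeries
  Walk s (zero  ∷ ℓ) = 0ℤ
  Walk s (suc n ∷ ℓ) = ℤ.+ walksFrom s n ℓ

  next : Fin m → Fin m → PowerSeries
  next s t = if f s t then 𝟘 else Walk t

  walksFrom-∷ : ∀ s n ℓ → walksFrom s n ℓ ≡ (if vecLeᵇ (𝕖 s) ℓ then continuations s n (ℓ ∸ᵛ 𝕖 s) else 0)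
  walksFrom-∷ s n ℓ = trans
    (∑-cong (words letters n) (λ w → cong (λ b → ⟦ b ∧ isHWalk f (s ∷ w) ⟧)
      (hasContent-∷ ℓ s w)))
    (trans (∑-cong (words letters n) (λ w → cong ⟦_⟧ (∧-assoc (vecLeᵇ (𝕖 s) ℓ) _ _)))
           (count-const-∧ (vecLeᵇ (𝕖 s) ℓ) (λ w → hasContent (ℓ ∸ᵛ 𝕖 s) w ∧ isHWalk f (s ∷ w)) (words letters n)))

  continuations-suc : ∀ s n ℓ → continuations s (suc n) ℓ ≡ ∑[ t ∈ letters ] (if f s t then 0 else walksFrom t n ℓ)
  continuations-suc s n ℓ = trans (∑-words-suc letters n _) (∑-cong letters λ t → trans
    (∑-cong (words letters n) (λ w → cong ⟦_⟧ (swap (hasContent ℓ (t ∷ w)) (not (f s t)) _)))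
    (trans (count-const-∧ (not (f s t)) (λ w → hasContent ℓ (t ∷ w) ∧ isHWalk f (t ∷ w)) (words letters n))
           (if-not (f s t))))
    where
    swap : ∀ a b c → a ∧ (b ∧ c) ≡ b ∧ (a ∧ c)
    swap a true  c = refl
    swap a false c = ∧-zeroʳ a

  continuations-series : ∀ s n ℓ → (𝟙 ⊕ ∑[ t < m ] next s t) (n ∷ ℓ) ≡ ℤ.+ continuations s n ℓ
  continuations-series s zero ℓ = begin
    (if 0ᵛ ≟ᵛ ℓ then 1ℤ else 0ℤ) + (∑[ t < m ] next s t) (0 ∷ ℓ)
      ≡⟨ cong (𝟙 (0 ∷ ℓ) +_) (∑-at-zero (next s) (0 ∷ ℓ) next-at-0) ⟩
    (if 0ᵛ ≟ᵛ ℓ then 1ℤ else 0ℤ) + 0ℤ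
      ≡⟨ ℤP.+-identityʳ _ ⟩
    (if 0ᵛ ≟ᵛ ℓ then 1ℤ else 0ℤ)
      ≡⟨ if-float ℤ.+_ (0ᵛ ≟ᵛ ℓ) ⟨
    ℤ.+ ⟦ 0ᵛ ≟ᵛ ℓ ⟧
      ≡⟨ cong ℤ.+_ (ℕP.+-identityʳ _) ⟨
    ℤ.+ (⟦ 0ᵛ ≟ᵛ ℓ ⟧ ℕ.+ 0)
      ≡⟨ cong (λ b → ℤ.+ (⟦ b ⟧ ℕ.+ 0)) (trans (∧-identityʳ _) (hasContent-[] ℓ)) ⟨
    ℤ.+ continuations s zero ℓ ∎
    where
    open ≡-Reasoning
    next-at-0 : ∀ t → next s t (0 ∷ ℓ) ≡ 0ℤ
    next-at-0 t with f s t
    ... | true  = refl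
    ... | false = refl
  continuations-series s (suc n) ℓ = trans (ℤP.+-identityˡ _) (trans
    (∑-at (next s) (λ t → if f s t then 0 else walksFrom t n ℓ) (suc n ∷ ℓ) next-at-suc)
    (cong ℤ.+_ (sym (continuations-suc s n ℓ))))
    where
    next-at-suc : ∀ t → next s t (suc n ∷ ℓ) ≡ ℤ.+ (if f s t then 0 else walksFrom t n ℓ)
    next-at-suc t with f s t
    ... | true  = refl
    ... | false = refl

  walk-step : ∀ s → Walk s ≗ z s ◃ (𝟙 ⊕ ∑[ t < m ] next s t)
  walk-step s (zero  ∷ ℓ) = refl
  walk-step s (suc n ∷ ℓ) rewrite walksFrom-∷ s n ℓ | continuations-series s n (ℓ ∸ᵛ 𝕖 s) with vecLeᵇ (𝕖 s) ℓ
  ... | true  = sym (ℤP.*-identityˡ _)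
  ... | false = refl

  walk-equation : ∀ s → Walk s ≗ (z s ∷ []) ⊙ 𝟙 ⊕ ∑[ t < m ] (edge s t ⊙ Walk t)
  walk-equation s = begin
    Walk s                                   ≈⟨ walk-step s ⟩
    z s ◃ (𝟙 ⊕ ∑[ t < m ] next s t)          ≈⟨ ⊕-identityʳ (z s ◃ (𝟙 ⊕ ∑[ t < m ] next s t)) ⟨
    zₛ ⊙ (𝟙 ⊕ ∑[ t < m ] next s t)           ≈⟨ ⊙-⊕ zₛ 𝟙 (∑[ t < m ] next s t) ⟩
    zₛ ⊙ 𝟙 ⊕ zₛ ⊙ ∑[ t < m ] next s t        ≈⟨ ⊕-congˡ (zₛ ⊙ 𝟙) (⊙-∑ zₛ (next s)) ⟩
    zₛ ⊙ 𝟙 ⊕ ∑[ t < m ] (zₛ ⊙ next s t)      ≈⟨ ⊕-congˡ (zₛ ⊙ 𝟙) (sum-cong-≋ edge-⊙) ⟩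
    zₛ ⊙ 𝟙 ⊕ ∑[ t < m ] (edge s t ⊙ Walk t)  ∎
    where
    open ≈-Reasoning
    zₛ : Polynomial
    zₛ = z s ∷ []
    edge-⊙ : ∀ t → zₛ ⊙ next s t ≗ edge s t ⊙ Walk t
    edge-⊙ t with f s t
    ... | true  = ⊙-𝟘 zₛ
    ... | false = λ _ → refl

  count-walks : ∀ {n ℓ} → Vec.sum ℓ ≡ n → count (walkOf ℓ) (words letters n) ≡ AH f ℓ
  count-walks {ℓ = ℓ} refl = sym (length-filterᵇ (walkOf ℓ) (words letters (Vec.sum ℓ)))

  count-walks-≢ : ∀ {n ℓ} → Vec.sum ℓ ≢ n → count (walkOf ℓ) (words letters n) ≡ 0
  count-walks-≢ {n} {ℓ} Σℓ≢n = trans (∑-words-cong letters n no-walk) (∑-zero (words letters n))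
    where
    no-walk : ∀ w → length w ≡ n → ⟦ walkOf ℓ w ⟧ ≡ 0
    no-walk w |w|≡n with hasContent ℓ w in h
    ... | true  = contradiction (trans (hasContent⇒sum≡length ℓ w h) |w|≡n) Σℓ≢n
    ... | false = refl

  genF-walks : F ≗ ∑[ s < m ] Walk s
  genF-walks (zero ∷ ℓ) = sym (∑-at-zero Walk (0 ∷ ℓ) (λ _ → refl))
  genF-walks (suc n ∷ ℓ) = begin
    (if does (Vec.sum ℓ ℕ.≟ suc n) then ℤ.+ AH f ℓ else 0ℤ)
      ≡⟨ coefficient (Vec.sum ℓ ℕ.≟ suc n) ⟩
    ℤ.+ count (walkOf ℓ) (words letters (suc n))
      ≡⟨ cong ℤ.+_ (∑-words-suc letters n (λ w → ⟦ walkOf ℓ w ⟧)) ⟩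
    ℤ.+ ∑[ s ∈ letters ] walksFrom s n ℓ
      ≡⟨ ∑-at Walk (λ s → walksFrom s n ℓ) (suc n ∷ ℓ) (λ _ → refl) ⟨
    (∑[ s < m ] Walk s) (suc n ∷ ℓ) ∎
    where
    open ≡-Reasoning
    coefficient : (d : Dec (Vec.sum ℓ ≡ suc n)) →
                  (if does d then ℤ.+ AH f ℓ else 0ℤ) ≡ ℤ.+ count (walkOf ℓ) (words letters (suc n))
    coefficient (yes Σℓ≡1+n) = cong ℤ.+_ (sym (count-walks {ℓ = ℓ} Σℓ≡1+n))
    coefficient (no  Σℓ≢1+n) = cong ℤ.+_ (sym (count-walks-≢ {ℓ = ℓ} Σℓ≢1+n))

  genF-equation : F ≗ ∑ᵖ (λ s → z s ∷ []) ⊙ 𝟙 ⊕ ∑[ t < m ] (∑ᵖ (λ s → edge s t) ⊙ Walk t)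
  genF-equation = begin
    F
      ≈⟨ genF-walks ⟩
    ∑[ s < m ] Walk s
      ≈⟨ sum-cong-≋ walk-equation ⟩
    ∑[ s < m ] ((z s ∷ []) ⊙ 𝟙 ⊕ ∑[ t < m ] (edge s t ⊙ Walk t))
      ≈⟨ ∑-distrib-+ (λ s → (z s ∷ []) ⊙ 𝟙) (λ s → ∑[ t < m ] (edge s t ⊙ Walk t)) ⟩
    ∑[ s < m ] ((z s ∷ []) ⊙ 𝟙) ⊕ ∑[ s < m ] ∑[ t < m ] (edge s t ⊙ Walk t)
      ≈⟨ ⊕-cong (⊙-∑ᵖ (λ s → z s ∷ []) 𝟙) (∑-comm (λ t s → edge s t ⊙ Walk t)) ⟨
    ∑ᵖ (λ s → z s ∷ []) ⊙ 𝟙 ⊕ ∑[ t < m ] ∑[ s < m ] (edge s t ⊙ Walk t)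
      ≈⟨ ⊕-congˡ (∑ᵖ (λ s → z s ∷ []) ⊙ 𝟙) (sum-cong-≋ (λ t → ⊙-∑ᵖ (λ s → edge s t) (Walk t))) ⟨
    ∑ᵖ (λ s → z s ∷ []) ⊙ 𝟙 ⊕ ∑[ t < m ] (∑ᵖ (λ s → edge s t) ⊙ Walk t) ∎
    where open ≈-Reasoning

  cst-edge : ∀ s t → cst (edge s t) ≡ 0ℤ
  cst-edge s t with f s t
  ... | true  = refl
  ... | false = refl

  unknown : Maybe (Fin m) → PowerSeries
  unknown nothing  = F
  unknown (just s) = Walk s

  walkSystem : LinearSystem m unknown
  walkSystem = record
    { D = λ _ → 1ᵖ ; b = b ; M = M
    ; cst-D≢0 = λ _ 1≡0 → case trans (sym cst-1ᵖ) 1≡0 of λ ()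
    ; cst-M≡0 = cst-M≡0 ; equation = equation }
    where
    b : Maybe (Fin m) → Polynomial
    b nothing  = ∑ᵖ (λ s → z s ∷ [])
    b (just s) = z s ∷ []
    M : Maybe (Fin m) → Maybe (Fin m) → Polynomial
    M _        nothing  = []
    M nothing  (just t) = ∑ᵖ (λ s → edge s t)
    M (just s) (just t) = edge s t
    cst-M≡0 : ∀ i j → cst (M i j) ≡ 0ℤ
    cst-M≡0 i        nothing  = refl
    cst-M≡0 nothing  (just t) =
      trans (⊙-∑ᵖ (λ s → edge s t) 𝟙 0ᵛ) (∑-at-zero (λ s → edge s t ⊙ 𝟙) 0ᵛ (λ s → cst-edge s t))
    cst-M≡0 (just s) (just t) = cst-edge s t
    equation : ∀ i → 1ᵖ ⊙ unknown i ≗ b i ⊙ 𝟙 ⊕ ∑ᴹ (λ j → M i j ⊙ unknown j)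
    equation nothing  v = trans (1ᵖ-⊙ (F) v) (trans (genF-equation v)
      (cong ((b nothing ⊙ 𝟙) v +_) (sym (ℤP.+-identityˡ _))))
    equation (just s) v = trans (1ᵖ-⊙ (Walk s) v) (trans (walk-equation s v)
      (cong ((b (just s) ⊙ 𝟙) v +_) (sym (ℤP.+-identityˡ _))))

  genF-rational : Rational (F)
  genF-rational = linearSystem⇒rational walkSystem

module Lifts where
  open import Defs using (hasContent; vecLeᵇ)
  open MultiIndex
  open Content
  open import Data.Bool using (true; false; if_then_else_)
  open import Data.Nat using (ℕ; zero; suc; _+_; _*_; _!)
  import Data.Nat.Properties as ℕP
  open import Data.Fin using (Fin; zero; suc)
  open import Data.Vec as Vec using (Vec; []; _∷_; lookup)
  open import Data.List using (List; []; _∷_; length; map; allFin)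
  open import Data.Nat.ListAction using (product)
  open Counting using (map-allFin-suc)
  open import Function using (case_of_)
  open import Relation.Binary.PropositionalEquality
  open import Algebra.Properties.CommutativeSemigroup ℕP.*-commutativeSemigroup using (x∙yz≈y∙xz)

  private variable
    m : ℕ

  ∏! : Vec ℕ m → ℕ
  ∏! []      = 1
  ∏! (x ∷ c) = x ! * ∏! c

  ∏!-0ᵛ : ∏! (0ᵛ {m}) ≡ 1
  ∏!-0ᵛ {zero}  = refl
  ∏!-0ᵛ {suc m} = trans (ℕP.+-identityʳ _) (∏!-0ᵛ {m})

  sum-∸ᵛ-𝕖 : ∀ (a : Fin m) c → vecLeᵇ (𝕖 a) c ≡ true → Vec.sum c ≡ suc (Vec.sum (c ∸ᵛ 𝕖 a))
  sum-∸ᵛ-𝕖 zero    (suc x ∷ c) _  rewrite ∸ᵛ-0ᵛ c = refl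
  sum-∸ᵛ-𝕖 (suc a) (x ∷ c)     le = trans (cong (x +_) (sum-∸ᵛ-𝕖 a c le)) (ℕP.+-suc x _)

  ∏!-∸ᵛ-𝕖 : ∀ (a : Fin m) c → vecLeᵇ (𝕖 a) c ≡ true → lookup c a * ∏! (c ∸ᵛ 𝕖 a) ≡ ∏! c
  ∏!-∸ᵛ-𝕖 zero    (suc x ∷ c) _  rewrite ∸ᵛ-0ᵛ c = sym (ℕP.*-assoc (suc x) (x !) (∏! c))
  ∏!-∸ᵛ-𝕖 (suc a) (x ∷ c)     le = trans (x∙yz≈y∙xz (lookup c a) (x !) _) (cong (x ! *_) (∏!-∸ᵛ-𝕖 a c le))

  lookup≡0 : ∀ (a : Fin m) c → vecLeᵇ (𝕖 a) c ≡ false → lookup c a ≡ 0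
  lookup≡0 a c ¬le with lookup c a | vecLeᵇ-𝕖 a c
  ... | zero  | _   = refl
  ... | suc _ | le≡ = case trans (sym le≡) ¬le of λ ()

  -- lifts c w is the number of ways to realise the word w by distinct elements drawn from a pool containing
  -- c_r elements labelled r, for each letter r.
  lifts : Vec ℕ m → List (Fin m) → ℕ
  lifts c []      = 1
  lifts c (a ∷ w) = lookup c a * lifts (c ∸ᵛ 𝕖 a) w

  lifts-formula : ∀ (w : List (Fin m)) c → length w ≡ Vec.sum c → lifts c w ≡ (if hasContent c w then ∏! c else 0)
  lifts-formula {m} [] c |w|≡Σc
    rewrite sum≡0⇒≡0ᵛ c (sym |w|≡Σc) | hasContent-[] (0ᵛ {m}) | ≟ᵛ-refl (0ᵛ {m}) = sym (∏!-0ᵛ {m})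
  lifts-formula (a ∷ w) c |w|≡Σc rewrite hasContent-∷ c a w with vecLeᵇ (𝕖 a) c in le
  ... | false rewrite lookup≡0 a c le = refl
  ... | true rewrite lifts-formula w (c ∸ᵛ 𝕖 a) (ℕP.suc-injective (trans |w|≡Σc (sum-∸ᵛ-𝕖 a c le)))
    with hasContent (c ∸ᵛ 𝕖 a) w
  ...   | true  = ∏!-∸ᵛ-𝕖 a c le
  ...   | false = ℕP.*-zeroʳ (lookup c a)

  ∏!-tabulate : ∀ (g : Fin m → ℕ) → ∏! (Vec.tabulate g) ≡ product (map (λ r → g r !) (allFin m))
  ∏!-tabulate {zero}  g = refl
  ∏!-tabulate {suc m} g = trans (cong (g zero ! *_) (∏!-tabulate (λ r → g (suc r))))
    (cong product (sym (map-allFin-suc (λ r → g r !))))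

module InjectiveWords where
  open import Defs using (words; elemℕ; distinctℕ)
  open Counting
  open import Data.Bool using (Bool; true; false; _∧_; _∨_; not; if_then_else_)
  open import Data.Bool.Properties using (∨-zeroʳ)
  open import Data.Nat using (ℕ; zero; suc; _<_; _≟_; s≤s; z≤n)
  import Data.Nat.Properties as ℕP
  open import Data.List using (List; []; _∷_; filterᵇ; applyUpTo)
  open import Relation.Nullary using (does; ¬_)
  open import Relation.Nullary.Decidable using (dec-true; dec-false)
  open import Relation.Binary.PropositionalEquality
  open import Data.Product using (_×_; _,_)

  without : ℕ → List ℕ → List ℕ
  without b = filterᵇ (λ x → not (does (b ≟ x)))

  distinct-∷ : ∀ x S → distinctℕ (x ∷ S) ≡ true → elemℕ x S ≡ false × distinctℕ S ≡ true
  distinct-∷ x S h with elemℕ x S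
  distinct-∷ x S h  | false = refl , h
  distinct-∷ x S () | true

  elemℕ-∷ : ∀ a S → elemℕ a (a ∷ S) ≡ true
  elemℕ-∷ a S rewrite dec-true (a ≟ a) refl = refl

  elemℕ-≢ : ∀ b x S → ¬ b ≡ x → elemℕ b (x ∷ S) ≡ elemℕ b S
  elemℕ-≢ b x S b≢x rewrite dec-false (b ≟ x) b≢x = refl

  elemℕ-head : ∀ a x S → elemℕ a (x ∷ S) ≡ false → does (a ≟ x) ≡ false
  elemℕ-head a x S h with does (a ≟ x)
  elemℕ-head a x S h  | false = refl
  elemℕ-head a x S () | true

  elemℕ-tail : ∀ a x S → elemℕ a (x ∷ S) ≡ false → elemℕ a S ≡ false
  elemℕ-tail a x S h with does (a ≟ x)
  elemℕ-tail a x S h  | false = h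
  elemℕ-tail a x S () | true

  without-head : ∀ b S → without b (b ∷ S) ≡ without b S
  without-head b S rewrite dec-true (b ≟ b) refl = refl

  without-≢ : ∀ b x S → ¬ b ≡ x → without b (x ∷ S) ≡ x ∷ without b S
  without-≢ b x S b≢x rewrite dec-false (b ≟ x) b≢x = refl

  without-∉ : ∀ b S → elemℕ b S ≡ false → without b S ≡ S
  without-∉ b []      _ = refl
  without-∉ b (x ∷ S) b∉S with does (b ≟ x)
  without-∉ b (x ∷ S) b∉S | false = cong (x ∷_) (without-∉ b S b∉S)
  without-∉ b (x ∷ S) ()  | true

  elemℕ-without : ∀ a b S → elemℕ a S ≡ false → elemℕ a (without b S) ≡ false
  elemℕ-without a b []      _ = refl
  elemℕ-without a b (x ∷ S) a∉S with not (does (b ≟ x))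
  ... | false = elemℕ-without a b S (elemℕ-tail a x S a∉S)
  ... | true rewrite elemℕ-head a x S a∉S = elemℕ-without a b S (elemℕ-tail a x S a∉S)

  distinct-without : ∀ b S → distinctℕ S ≡ true → distinctℕ (without b S) ≡ true
  distinct-without b []      _ = refl
  distinct-without b (x ∷ S) h with elemℕ x S in x∉S | not (does (b ≟ x))
  distinct-without b (x ∷ S) h  | false | true rewrite elemℕ-without x b S x∉S = distinct-without b S h
  distinct-without b (x ∷ S) h  | false | false = distinct-without b S h
  distinct-without b (x ∷ S) () | true  | _

  ∑-cong-elemℕ : ∀ S {g h : ℕ → ℕ} → (∀ b → elemℕ b S ≡ true → g b ≡ h b) →
                 ∑[ b ∈ S ] g b ≡ ∑[ b ∈ S ] h b
  ∑-cong-elemℕ []      _   = refl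
  ∑-cong-elemℕ (x ∷ S) g≗h = cong₂ Data.Nat._+_ (g≗h x (elemℕ-∷ x S))
    (∑-cong-elemℕ S (λ b b∈S → g≗h b (trans (cong (does (b ≟ x) ∨_) b∈S) (∨-zeroʳ _))))

  count-avoiding : ∀ b (p : List ℕ → Bool) S k →
                   count (λ π → not (elemℕ b π) ∧ p π) (words S k) ≡ count p (words (without b S) k)
  count-avoiding b p S zero    = refl
  count-avoiding b p S (suc k) = begin
    count (λ π → not (elemℕ b π) ∧ p π) (words S (suc k))
      ≡⟨ ∑-words-suc S k _ ⟩
    ∑[ a ∈ S ] count (λ π → not (elemℕ b (a ∷ π)) ∧ p (a ∷ π)) (words S k)
      ≡⟨ ∑-cong S (λ a → trans
           (∑-cong (words S k) (λ π → cong ⟦_⟧ (not-∨-∧ (does (b ≟ a)) (elemℕ b π) (p (a ∷ π)))))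
           (count-const-∧ (not (does (b ≟ a))) (λ π → not (elemℕ b π) ∧ p (a ∷ π)) (words S k))) ⟩
    ∑[ a ∈ S ] (if not (does (b ≟ a)) then count (λ π → not (elemℕ b π) ∧ p (a ∷ π)) (words S k) else 0)
      ≡⟨ ∑-cong S (λ a → cong (if not (does (b ≟ a)) then_else 0) (count-avoiding b (λ π → p (a ∷ π)) S k)) ⟩
    ∑[ a ∈ S ] (if not (does (b ≟ a)) then count (λ π → p (a ∷ π)) (words (without b S) k) else 0)
      ≡⟨ ∑-filterᵇ (λ a → not (does (b ≟ a))) (λ a → count (λ π → p (a ∷ π)) (words (without b S) k)) S ⟨
    ∑[ a ∈ without b S ] count (λ π → p (a ∷ π)) (words (without b S) k)
      ≡⟨ ∑-words-suc (without b S) k _ ⟨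
    count p (words (without b S) (suc k)) ∎
    where
    open ≡-Reasoning
    not-∨-∧ : ∀ x y z → not (x ∨ y) ∧ z ≡ not x ∧ (not y ∧ z)
    not-∨-∧ true  y z = refl
    not-∨-∧ false y z = refl

  elemℕ-applyUpTo : ∀ (g : ℕ → ℕ) n x → (∀ i → x < g i) → elemℕ x (applyUpTo g n) ≡ false
  elemℕ-applyUpTo g zero    x x<g = refl
  elemℕ-applyUpTo g (suc n) x x<g rewrite dec-false (x ≟ g 0) (ℕP.<⇒≢ (x<g 0)) =
    elemℕ-applyUpTo (λ i → g (suc i)) n x (λ i → x<g (suc i))

  distinct-applyUpTo : ∀ (g : ℕ → ℕ) n → (∀ {i j} → i < j → g i < g j) → distinctℕ (applyUpTo g n) ≡ true
  distinct-applyUpTo g zero    g-mono = refl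
  distinct-applyUpTo g (suc n) g-mono
    rewrite elemℕ-applyUpTo (λ i → g (suc i)) n (g 0) (λ i → g-mono (s≤s z≤n)) =
    distinct-applyUpTo (λ i → g (suc i)) n (λ i<j → g-mono (s≤s i<j))

module Residues {m : ℕ} (ρ : ℕ → Fin m) where
  open import Defs using (words; elemℕ; distinctℕ; noXDes; isHWalk)
  open Counting
  open MultiIndex
  open Content
  open Lifts
  open InjectiveWords
  open import Data.Bool using (Bool; true; false; _∧_; not; if_then_else_)
  open import Data.Bool.Properties using (∧-assoc)
  open import Data.Nat using (ℕ; zero; suc; _*_; _≟_)
  import Data.Nat.Properties as ℕP
  open import Data.Fin as Fin using (Fin)
  open import Data.Vec using (Vec; lookup; sum)
  open import Data.List using (List; []; _∷_; map; allFin; filterᵇ; length)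
  import Data.List.Properties as ListP
  open import Data.Product using (proj₁; proj₂)
  open import Function using (case_of_)
  open import Relation.Nullary using (does; yes; no; ¬_)
  open import Relation.Binary.PropositionalEquality

  residues : List ℕ → Vec ℕ m
  residues S = content (map ρ S)

  lookup-residues : ∀ S r → lookup (residues S) r ≡ length (filterᵇ (λ t → does (ρ t Fin.≟ r)) S)
  lookup-residues S r = begin
    lookup (content (map ρ S)) r                           ≡⟨ lookup-content (map ρ S) r ⟩
    length (filterᵇ (λ a → does (a Fin.≟ r)) (map ρ S))    ≡⟨ length-filterᵇ _ (map ρ S) ⟩
    count (λ a → does (a Fin.≟ r)) (map ρ S)               ≡⟨ ∑-map ρ (λ a → ⟦ does (a Fin.≟ r) ⟧) S ⟩
    count (λ t → does (ρ t Fin.≟ r)) S                     ≡⟨ length-filterᵇ (λ t → does (ρ t Fin.≟ r)) S ⟨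
    length (filterᵇ (λ t → does (ρ t Fin.≟ r)) S)          ∎
    where open ≡-Reasoning

  sum-residues : ∀ S → sum (residues S) ≡ length S
  sum-residues S = trans (sum-content (map ρ S)) (ListP.length-map ρ S)

  residues-without : ∀ b S → distinctℕ S ≡ true → elemℕ b S ≡ true →
                     residues S ≡ 𝕖 (ρ b) +ᵛ residues (without b S)
  residues-without b (x ∷ S) hd b∈S with b ≟ x
  ... | yes refl rewrite without-head b S | without-∉ b S (proj₁ (distinct-∷ b S hd)) = refl
  ... | no  b≢x rewrite without-≢ b x S b≢x = trans
    (cong (𝕖 (ρ x) +ᵛ_) (residues-without b S (proj₂ (distinct-∷ x S hd)) (trans (sym (elemℕ-≢ b x S b≢x)) b∈S)))
    (+ᵛ-left-comm (𝕖 (ρ x)) (𝕖 (ρ b)) (residues (without b S)))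

  residues-without-∸ᵛ : ∀ b S → distinctℕ S ≡ true → elemℕ b S ≡ true →
                        residues (without b S) ≡ residues S ∸ᵛ 𝕖 (ρ b)
  residues-without-∸ᵛ b S hd b∈S =
    sym (trans (cong (_∸ᵛ 𝕖 (ρ b)) (residues-without b S hd b∈S)) (+ᵛ-∸ᵛ-cancelˡ (𝕖 (ρ b)) _))

  count-injective-words : ∀ k S → distinctℕ S ≡ true → (Wp : List (Fin m) → Bool) →
    count (λ π → distinctℕ π ∧ Wp (map ρ π)) (words S k)
      ≡ ∑[ w ∈ words (allFin m) k ] (if Wp w then lifts (residues S) w else 0)
  count-injective-words zero    S hd Wp = refl
  count-injective-words (suc k) S hd Wp = begin
    count (λ π → distinctℕ π ∧ Wp (map ρ π)) (words S (suc k))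
      ≡⟨ ∑-words-suc S k _ ⟩
    ∑[ b ∈ S ] count (λ π → distinctℕ (b ∷ π) ∧ Wp (ρ b ∷ map ρ π)) (words S k)
      ≡⟨ ∑-cong-elemℕ S first-letter ⟩
    ∑[ b ∈ S ] H (ρ b)
      ≡⟨ ∑-map ρ H S ⟨
    ∑[ a ∈ map ρ S ] H a
      ≡⟨ ∑-content (map ρ S) H ⟩
    ∑[ a ∈ allFin m ] (lookup c a * H a)
      ≡⟨ ∑-cong (allFin m) (λ a → trans (∑-cong (words (allFin m) k) (λ w → if-* (Wp (a ∷ w)) (lookup c a)))
                                        (∑-*ˡ (lookup c a) _ (words (allFin m) k))) ⟨
    ∑[ a ∈ allFin m ] ∑[ w ∈ words (allFin m) k ] (if Wp (a ∷ w) then lifts c (a ∷ w) else 0)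
      ≡⟨ ∑-words-suc (allFin m) k (λ w → if Wp w then lifts c w else 0) ⟨
    ∑[ w ∈ words (allFin m) (suc k) ] (if Wp w then lifts c w else 0) ∎
    where
    open ≡-Reasoning
    c = residues S
    H : Fin m → ℕ
    H a = ∑[ w ∈ words (allFin m) k ] (if Wp (a ∷ w) then lifts (c ∸ᵛ 𝕖 a) w else 0)
    if-* : ∀ b x {y} → (if b then x * y else 0) ≡ x * (if b then y else 0)
    if-* true  x = refl
    if-* false x = sym (ℕP.*-zeroʳ x)
    first-letter : ∀ b → elemℕ b S ≡ true →
                   count (λ π → distinctℕ (b ∷ π) ∧ Wp (ρ b ∷ map ρ π)) (words S k) ≡ H (ρ b)
    first-letter b b∈S = begin
      count (λ π → (not (elemℕ b π) ∧ distinctℕ π) ∧ Wp (ρ b ∷ map ρ π)) (words S k)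
        ≡⟨ ∑-cong (words S k) (λ π → cong ⟦_⟧ (∧-assoc (not (elemℕ b π)) _ _)) ⟩
      count (λ π → not (elemℕ b π) ∧ (distinctℕ π ∧ Wp (ρ b ∷ map ρ π))) (words S k)
        ≡⟨ count-avoiding b (λ π → distinctℕ π ∧ Wp (ρ b ∷ map ρ π)) S k ⟩
      count (λ π → distinctℕ π ∧ Wp (ρ b ∷ map ρ π)) (words (without b S) k)
        ≡⟨ count-injective-words k (without b S) (distinct-without b S hd) (λ w → Wp (ρ b ∷ w)) ⟩
      ∑[ w ∈ words (allFin m) k ] (if Wp (ρ b ∷ w) then lifts (residues (without b S)) w else 0)
        ≡⟨ cong (λ c′ → ∑[ w ∈ words (allFin m) k ] (if Wp (ρ b ∷ w) then lifts c′ w else 0))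
                (residues-without-∸ᵛ b S hd b∈S) ⟩
      H (ρ b) ∎

  module _ (X : ℕ → ℕ → Bool) (f : Fin m → Fin m → Bool)
           (X≡f : ∀ a b → ¬ a ≡ b → X a b ≡ f (ρ a) (ρ b)) where

    noXDes≡isHWalk : ∀ π → distinctℕ π ≡ true → noXDes X π ≡ isHWalk f (map ρ π)
    noXDes≡isHWalk []          _  = refl
    noXDes≡isHWalk (a ∷ [])    _  = refl
    noXDes≡isHWalk (a ∷ b ∷ π) hd =
      cong₂ _∧_ (cong not (X≡f a b a≢b)) (noXDes≡isHWalk (b ∷ π) (proj₂ (distinct-∷ a (b ∷ π) hd)))
      where
      a≢b : ¬ a ≡ b
      a≢b refl = case trans (sym (elemℕ-∷ a π)) (proj₁ (distinct-∷ a (b ∷ π) hd)) of λ ()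

module PermutationCount (m : ℕ) .{{_ : NonZero m}} where
  open import Defs using (dX∅; AH; ellr; ellVec; prodFact; range1; words; distinctℕ; noXDes; isHWalk; hasContent)
  open import Data.Bool using (Bool; true; false; _∧_; if_then_else_)
  open import Data.Nat using (ℕ; suc; _*_; NonZero; s≤s)
  import Data.Nat.Properties as ℕP
  open import Data.Fin using (Fin)
  open import Data.Nat.DivMod using (_mod_)
  open import Data.Vec as Vec using (Vec)
  import Data.Vec.Properties as VecP
  open import Data.List using (List; allFin; filterᵇ; length; map)
  import Data.List.Properties as ListP
  open import Relation.Nullary using (¬_)
  open import Relation.Binary.PropositionalEquality
  open Counting
  open Lifts
  open InjectiveWords using (distinct-applyUpTo)

  open Residues (_mod m)

  residues-range : ∀ n → residues (range1 n) ≡ ellVec m n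
  residues-range n = trans (sym (VecP.tabulate∘lookup (residues (range1 n))))
    (VecP.tabulate-cong (lookup-residues (range1 n)))

  sum-ellVec : ∀ n → Vec.sum (ellVec m n) ≡ n
  sum-ellVec n = trans (cong Vec.sum (sym (residues-range n)))
    (trans (sum-residues (range1 n)) (ListP.length-applyUpTo suc n))

  module _ (X : ℕ → ℕ → Bool) (f : Fin m → Fin m → Bool)
           (X≡f : ∀ a b → ¬ a ≡ b → X a b ≡ f (a mod m) (b mod m)) where
    open HWalks f using (walkOf; count-walks)

    dX∅≡∑-lifts : ∀ n → dX∅ X n ≡ ∑[ w ∈ words (allFin m) n ] (if isHWalk f w then lifts (ellVec m n) w else 0)
    dX∅≡∑-lifts n = begin
      length (filterᵇ (noXDes X) (filterᵇ distinctℕ Π))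
        ≡⟨ length-filterᵇ (noXDes X) (filterᵇ distinctℕ Π) ⟩
      count (noXDes X) (filterᵇ distinctℕ Π)
        ≡⟨ count-filterᵇ distinctℕ (noXDes X) Π ⟩
      count (λ π → distinctℕ π ∧ noXDes X π) Π
        ≡⟨ ∑-cong Π (λ π → cong ⟦_⟧ (on-distinct π)) ⟩
      count (λ π → distinctℕ π ∧ isHWalk f (map (_mod m) π)) Π
        ≡⟨ count-injective-words n (range1 n) (distinct-applyUpTo suc n s≤s) (isHWalk f) ⟩
      ∑[ w ∈ words (allFin m) n ] (if isHWalk f w then lifts (residues (range1 n)) w else 0)
        ≡⟨ cong (λ c → ∑[ w ∈ words (allFin m) n ] (if isHWalk f w then lifts c w else 0)) (residues-range n) ⟩
      ∑[ w ∈ words (allFin m) n ] (if isHWalk f w then lifts (ellVec m n) w else 0) ∎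
      where
      open ≡-Reasoning
      Π = words (range1 n) n
      on-distinct : ∀ π → distinctℕ π ∧ noXDes X π ≡ distinctℕ π ∧ isHWalk f (map (_mod m) π)
      on-distinct π with distinctℕ π in distinct
      ... | true  = noXDes≡isHWalk X f X≡f π distinct
      ... | false = refl

    ∑-lifts≡AH*prodFact : ∀ n → ∑[ w ∈ words (allFin m) n ] (if isHWalk f w then lifts (ellVec m n) w else 0)
                              ≡ AH f (ellVec m n) * prodFact m n
    ∑-lifts≡AH*prodFact n = begin
      ∑[ w ∈ words (allFin m) n ] (if isHWalk f w then lifts c w else 0)
        ≡⟨ ∑-words-cong (allFin m) n (λ w |w|≡n → walk-lifts w (trans |w|≡n (sym (sum-ellVec n)))) ⟩
      ∑[ w ∈ words (allFin m) n ] (∏! c * ⟦ walkOf c w ⟧)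
        ≡⟨ ∑-*ˡ (∏! c) (λ w → ⟦ walkOf c w ⟧) (words (allFin m) n) ⟩
      ∏! c * count (walkOf c) (words (allFin m) n)
        ≡⟨ cong₂ _*_ (∏!-tabulate (λ r → ellr m r n)) (count-walks {ℓ = c} (sum-ellVec n)) ⟩
      prodFact m n * AH f c
        ≡⟨ ℕP.*-comm (prodFact m n) (AH f c) ⟩
      AH f c * prodFact m n ∎
      where
      open ≡-Reasoning
      c = ellVec m n
      walk-lifts : ∀ w → length w ≡ Vec.sum c →
                   (if isHWalk f w then lifts c w else 0) ≡ ∏! c * ⟦ walkOf c w ⟧
      walk-lifts w len rewrite lifts-formula w c len with isHWalk f w | hasContent c w
      ... | true  | true  = sym (ℕP.*-identityʳ (∏! c))
      ... | true  | false = sym (ℕP.*-zeroʳ (∏! c))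
      ... | false | true  = sym (ℕP.*-zeroʳ (∏! c))
      ... | false | false = sym (ℕP.*-zeroʳ (∏! c))

open import Defs using (dX∅; AH; ellVec; prodFact; genF; IsRational)
open import Data.Nat using (ℕ; _*_; _≥_; NonZero)
open import Data.Nat.DivMod using (_mod_)
open import Data.Product using (_×_; _,_)
open import Relation.Nullary using (¬_)
open import Relation.Binary.PropositionalEquality using (_≡_; trans)
open CurriedSeries using (rational⇒isRational)
open PermutationCount using (dX∅≡∑-lifts; ∑-lifts≡AH*prodFact)

theorem3p8 : (m : ℕ) .{{_ : NonZero m}} (X : ℕ → ℕ → Bool) (f : Fin m → Fin m → Bool) →
    (∀ a b → ¬ (a ≡ b) → X a b ≡ f (a mod m) (b mod m)) →
    (∀ n → n ≥ 1 → dX∅ X n ≡ AH f (ellVec m n) * prodFact m n) × IsRational (genF f)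
-- The formula also holds for n = 0.
theorem3p8 m X f X≡f =
  (λ n _ → trans (dX∅≡∑-lifts m X f X≡f n) (∑-lifts≡AH*prodFact m X f X≡f n)) ,
  rational⇒isRational (genF f) (HWalks.genF-rational f)
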